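{- Let $n\geq 1$, $P=\{p_1>p_2>\cdots>p_k\}\subseteq[n]$ with $k=|P|$, $p_0=n+1$, $p_{k+1}=1$. Let $W_k$ be the set of integer sequences $(w_0,w_1,\ldots,w_k)$ with $w_0=0$ and $w_m=w_{m-1}\pm1$ for $1\le m\le k$ (walks with steps $[1,1]$ and $[1,-1]$ ending at any height, with no positivity restriction). Then $$\sum_{Q\subseteq P}2^{|Q|+1}|p_n(Q)| = 2^{n-k}\sum_{w\in W_k}\prod_{m=0}^{k}(w_m+1)^{p_m-p_{m+1}}.$$
   Context: For $\pi\in S_n$, $\mathrm{Pin}\,\pi=\{\pi_i: 1<i<n,\ \pi_{i-1}<\pi_i>\pi_{i+1}\}$, and for $Q\subseteq[n]$, $p_n(Q)=\{\pi\in S_n:\mathrm{Pin}\,\pi=Q\}$. The convention $0^0=1$ is used. -}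

module Defs where

open import Data.Nat using (ℕ; zero; suc; _+_; _*_; _∸_; _^_; _<ᵇ_; _≡ᵇ_)
open import Data.Integer as ℤ using (ℤ; +_; -[1+_])
open import Data.Bool using (Bool; true; false; _∧_; _∨_; not; if_then_else_)
open import Data.List using (List; []; _∷_; map; filter; length; concatMap; upTo; _++_; foldr)
open import Data.Bool.ListAction using (all; any)
open import Data.Nat.ListAction using (sum)
open import Data.List.Relation.Unary.All using (All)

open import Relation.Unary using (Decidable)

range1 : ℕ → List ℕ
range1 n = map suc (upTo n)

elemᵇ : ℕ → List ℕ → Bool
elemᵇ v xs = any (λ x → v ≡ᵇ x) xs

words : ℕ → ℕ → List (List ℕ)
words n zero    = [] ∷ []
words n (suc l) = concatMap (λ a → map (a ∷_) (words n l)) (range1 n)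

distinctᵇ : List ℕ → Bool
distinctᵇ []       = true
distinctᵇ (x ∷ xs) = not (elemᵇ x xs) ∧ distinctᵇ xs

-- S_n : all permutations of [n] in one-line notation (π₁ … πₙ)
Sn : ℕ → List (List ℕ)
Sn n = filter (λ w → distinctᵇ w Data.Bool.≟ true) (words n n)

Pin : List ℕ → List ℕ
Pin (a ∷ b ∷ c ∷ rest) =
  (if (a <ᵇ b) ∧ (c <ᵇ b) then b ∷ [] else []) ++ Pin (b ∷ c ∷ rest)
Pin _ = []

sameSetᵇ : ℕ → List ℕ → List ℕ → Bool
sameSetᵇ n A B = all (λ v → elemᵇ v A ≡ᵇᵇ elemᵇ v B) (range1 n)
  where
  _≡ᵇᵇ_ : Bool → Bool → Bool
  true  ≡ᵇᵇ y = y
  false ≡ᵇᵇ y = not y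

pnCard : ℕ → List ℕ → ℕ
pnCard n Q = length (filter (λ π → sameSetᵇ n (Pin π) Q Data.Bool.≟ true) (Sn n))

-- all subsets of a list (as sublists); for a list of distinct entries,
-- each subset appears exactly once
subsets : List ℕ → List (List ℕ)
subsets []       = [] ∷ []
subsets (x ∷ xs) = subsets xs ++ map (x ∷_) (subsets xs)

data StrictDec : List ℕ → Set where
  []  : StrictDec []
  [_] : ∀ x → StrictDec (x ∷ [])
  _∷_ : ∀ {x y ys} → Data.Nat._<_ y x → StrictDec (y ∷ ys) → StrictDec (x ∷ y ∷ ys)

lhs : ℕ → List ℕ → ℕ
lhs n P = sum (map (λ Q → 2 ^ (length Q + 1) * pnCard n Q) (subsets P))

walksFrom : ℤ → ℕ → List (List ℤ)
walksFrom h zero    = (h ∷ []) ∷ []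
walksFrom h (suc k) =
  map (h ∷_) (walksFrom (h ℤ.+ + 1) k) ++ map (h ∷_) (walksFrom (h ℤ.- + 1) k)

W : ℕ → List (List ℤ)
W k = walksFrom (+ 0) k

pSeq : ℕ → List ℕ → List ℕ
pSeq n P = suc n ∷ (P ++ (1 ∷ []))

diffs : List ℕ → List ℕ
diffs (a ∷ b ∷ rest) = (a ∸ b) ∷ diffs (b ∷ rest)
diffs _ = []

-- ∏_{m=0}^{k} (w_m + 1)^{e_m}   (ℤ power, with 0^0 = 1)
prodPow : List ℤ → List ℕ → ℤ
prodPow (w ∷ ws) (e ∷ es) = ((w ℤ.+ + 1) ℤ.^ e) ℤ.* prodPow ws es
prodPow _ _ = + 1

sumℤ : List ℤ → ℤ
sumℤ = foldr ℤ._+_ (+ 0)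

rhs : ℕ → List ℕ → ℤ
rhs n P = (+ (2 ^ (n ∸ length P))) ℤ.* sumℤ (map (λ w → prodPow w (diffs (pSeq n P))) (W (length P)))

{-# OPTIONS --safe #-}
module Submission where

-- For a fixed π, Σ_{Q ⊆ P} 2^|Q| [Pin π = Q] is a product over v ∈ [n] of 2 if v is a
-- pinnacle in P, 0 if it is a pinnacle outside P and 1 otherwise, so the left side is twice a
-- weighted count of permutations.  That count is built one value at a time: at threshold m every
-- maximal run of values ≤ m of π is collapsed to a single block.  Summed over the permutations
-- with a given pattern, the weight only depends on the number g of blocks, and value m+1 enters
-- one of the g blocks alone, at one of its two ends, or strictly inside it, where it is a
-- pinnacle:  fill(m+1, g) = g (fill(m, g-1) + 2 fill(m, g) + c(m+1) fill(m, g+1)).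
-- The transform Σ_g C(x,g) 2^g fill(m, g) turns this into H(m+1, x) = x (H(m, x+1) + H(m, x-1))
-- for m+1 ∈ P and 2x H(m, x) otherwise; unfolding it from x = 1 down to m = 0 gives the walk
-- sum, each p ∈ P being a step and each stretch between consecutive elements of P contributing
-- (2 (w + 1)) to the power of its length.

open import Algebra.Properties.CommutativeSemigroup as CommSemigroupProperties using ()
open import Data.Bool using (Bool; true; false; if_then_else_; _∧_; _∨_; not; T)
open import Data.Bool.ListAction using (all)
open import Data.Bool.Properties using (∧-zeroʳ; ∧-identityʳ; ∨-identityʳ; ∨-assoc; T-≡)
open import Data.Empty using (⊥; ⊥-elim)
open import Data.Integer as ℤ using (ℤ)
import Data.Integer.Properties as ℤ
import Data.Integer.Tactic.RingSolver as ℤ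
open import Data.List using (List; []; _∷_; map; length; _++_; filter; concatMap; upTo)
open import Data.List.Membership.Propositional using (_∈_)
open import Data.List.Properties using (map-++; map-∘; upTo-∷ʳ; length-map; length-upTo)
open import Data.List.Relation.Unary.All as All using (All; []; _∷_)
import Data.List.Relation.Unary.All.Properties as All
open import Data.List.Relation.Unary.Any using (here; there)
open import Data.Nat using (ℕ; zero; suc; _+_; _*_; _∸_; _^_; _≤_; _<_; z≤n; s≤s; _≡ᵇ_; _<ᵇ_)
open import Data.Nat.ListAction using (sum; product)
open import Data.Nat.ListAction.Properties using (sum-++; product-++)
open import Data.Nat.Properties
open import Data.Nat.Tactic.RingSolver using (solve-∀)
open import Data.Product using (Σ; _×_; _,_; proj₁; proj₂)
open import Data.Sum using (inj₁; inj₂)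
open import Data.Unit using (⊤; tt)
open import Function using (_∘_)
open import Function.Bundles using (Equivalence)
open import Relation.Binary.PropositionalEquality
open import Relation.Nullary using (contradiction)
open import Relation.Unary using (Decidable)
open ≡-Reasoning

open import Defs

open CommSemigroupProperties +-commutativeSemigroup using ()
  renaming (interchange to +-interchange; x∙yz≈y∙xz to m+[n+o]≡n+[m+o])
open CommSemigroupProperties *-commutativeSemigroup using ()
  renaming (x∙yz≈y∙xz to m*[n*o]≡n*[m*o])

private variable
  A B : Set

⟦_⟧ : Bool → ℕ
⟦ true ⟧  = 1
⟦ false ⟧ = 0

⟦⟧-∧ : ∀ a b → ⟦ a ∧ b ⟧ ≡ ⟦ a ⟧ * ⟦ b ⟧
⟦⟧-∧ true  b = sym (+-identityʳ _)
⟦⟧-∧ false b = refl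

⟦⟧≤1 : ∀ b → ⟦ b ⟧ ≤ 1
⟦⟧≤1 true  = s≤s z≤n
⟦⟧≤1 false = z≤n

⟦⟧≡0 : ∀ {b} → ⟦ b ⟧ ≡ 0 → b ≡ false
⟦⟧≡0 {false} _ = refl

≡ᵇ-refl : ∀ n → (n ≡ᵇ n) ≡ true
≡ᵇ-refl zero    = refl
≡ᵇ-refl (suc n) = ≡ᵇ-refl n

≡ᵇ-sym : ∀ m n → (m ≡ᵇ n) ≡ (n ≡ᵇ m)
≡ᵇ-sym zero    zero    = refl
≡ᵇ-sym zero    (suc n) = refl
≡ᵇ-sym (suc m) zero    = refl
≡ᵇ-sym (suc m) (suc n) = ≡ᵇ-sym m n

≡ᵇ-true⇒≡ : ∀ m n → (m ≡ᵇ n) ≡ true → m ≡ n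
≡ᵇ-true⇒≡ m n m≡ᵇn = ≡ᵇ⇒≡ m n (subst T (sym m≡ᵇn) _)

≢⇒≡ᵇ-false : ∀ m n → m ≢ n → (m ≡ᵇ n) ≡ false
≢⇒≡ᵇ-false zero    zero    m≢n = ⊥-elim (m≢n refl)
≢⇒≡ᵇ-false zero    (suc n) m≢n = refl
≢⇒≡ᵇ-false (suc m) zero    m≢n = refl
≢⇒≡ᵇ-false (suc m) (suc n) m≢n = ≢⇒≡ᵇ-false m n (m≢n ∘ cong suc)

<ᵇ-irrefl : ∀ n → (n <ᵇ n) ≡ false
<ᵇ-irrefl zero    = refl
<ᵇ-irrefl (suc n) = <ᵇ-irrefl n

<ᵇ-suc-refl : ∀ n → (n <ᵇ suc n) ≡ true
<ᵇ-suc-refl zero    = refl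
<ᵇ-suc-refl (suc n) = <ᵇ-suc-refl n

<ᵇ-weaken : ∀ a b → (a <ᵇ b) ≡ true → (a <ᵇ suc b) ≡ true
<ᵇ-weaken zero    b       _ = refl
<ᵇ-weaken (suc a) (suc b) a<b = <ᵇ-weaken a b a<b

<ᵇ⇒≢ : ∀ a b → (a <ᵇ b) ≡ true → (b ≡ᵇ a) ≡ false
<ᵇ⇒≢ zero    (suc b) _   = refl
<ᵇ⇒≢ (suc a) (suc b) a<b = <ᵇ⇒≢ a b a<b

<ᵇ-boundary : ∀ a b → (a <ᵇ suc b) ≡ true → (a <ᵇ b) ≡ false → (b ≡ᵇ a) ≡ true
<ᵇ-boundary zero    zero    _ _ = refl
<ᵇ-boundary (suc a) (suc b) a≤b a≮b = <ᵇ-boundary a b a≤b a≮b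

≮ᵇ⇒≢ : ∀ a b → (a <ᵇ suc b) ≡ false → (b ≡ᵇ a) ≡ false
≮ᵇ⇒≢ (suc a) zero    _   = refl
≮ᵇ⇒≢ (suc a) (suc b) a≰b = ≮ᵇ⇒≢ a b a≰b

<ᵇ-suc-≢ : ∀ u y → (u ≡ᵇ y) ≡ false → (u <ᵇ suc y) ≡ (u <ᵇ y)
<ᵇ-suc-≢ zero    (suc y) _   = refl
<ᵇ-suc-≢ (suc u) zero    _   = refl
<ᵇ-suc-≢ (suc u) (suc y) u≢y = <ᵇ-suc-≢ u y u≢y

⟦<ᵇ-suc⟧ : ∀ a b → ⟦ a <ᵇ b ⟧ + ⟦ a ≡ᵇ b ⟧ ≡ ⟦ a <ᵇ suc b ⟧
⟦<ᵇ-suc⟧ zero    zero    = refl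
⟦<ᵇ-suc⟧ zero    (suc b) = refl
⟦<ᵇ-suc⟧ (suc a) zero    = refl
⟦<ᵇ-suc⟧ (suc a) (suc b) = ⟦<ᵇ-suc⟧ a b

infix 4 _==_

_==_ : List ℕ → List ℕ → Bool
[]       == []       = true
[]       == (_ ∷ _)  = false
(_ ∷ _)  == []       = false
(x ∷ xs) == (y ∷ ys) = (x ≡ᵇ y) ∧ (xs == ys)

==-true⇒≡ : ∀ xs ys → (xs == ys) ≡ true → xs ≡ ys
==-true⇒≡ []       []       _ = refl
==-true⇒≡ (x ∷ xs) (y ∷ ys) e with x ≡ᵇ y in x≡ᵇy
... | true = cong₂ _∷_ (≡ᵇ-true⇒≡ x y x≡ᵇy) (==-true⇒≡ xs ys e)

∑ : List A → (A → ℕ) → ℕ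
∑ xs f = sum (map f xs)

∑-++ : (xs ys : List A) (f : A → ℕ) → ∑ (xs ++ ys) f ≡ ∑ xs f + ∑ ys f
∑-++ xs ys f = trans (cong sum (map-++ f xs ys)) (sum-++ (map f xs) (map f ys))

∑-map : (g : A → B) (xs : List A) (f : B → ℕ) → ∑ (map g xs) f ≡ ∑ xs (f ∘ g)
∑-map g xs f = cong sum (sym (map-∘ xs))

∑-concatMap : (g : A → List B) (xs : List A) (f : B → ℕ) →
  ∑ (concatMap g xs) f ≡ ∑ xs (λ x → ∑ (g x) f)
∑-concatMap g [] f = refl
∑-concatMap g (x ∷ xs) f =
  trans (∑-++ (g x) (concatMap g xs) f) (cong (∑ (g x) f +_) (∑-concatMap g xs f))

∑-cong : (xs : List A) {f g : A → ℕ} → (∀ x → f x ≡ g x) → ∑ xs f ≡ ∑ xs g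
∑-cong [] e = refl
∑-cong (x ∷ xs) e = cong₂ _+_ (e x) (∑-cong xs e)

∑-congᴬ : {P : A → Set} (xs : List A) {f g : A → ℕ} →
  All P xs → (∀ x → P x → f x ≡ g x) → ∑ xs f ≡ ∑ xs g
∑-congᴬ [] [] e = refl
∑-congᴬ (x ∷ xs) (px ∷ pxs) e = cong₂ _+_ (e x px) (∑-congᴬ xs pxs e)

∑-zero : (xs : List A) {f : A → ℕ} → (∀ x → f x ≡ 0) → ∑ xs f ≡ 0
∑-zero [] e = refl
∑-zero (x ∷ xs) e = cong₂ _+_ (e x) (∑-zero xs e)

∑-+ : (xs : List A) (f g : A → ℕ) → ∑ xs (λ x → f x + g x) ≡ ∑ xs f + ∑ xs g
∑-+ [] f g = refl
∑-+ (x ∷ xs) f g = trans (cong (f x + g x +_) (∑-+ xs f g)) (+-interchange (f x) (g x) _ _)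

∑-*ˡ : (xs : List A) (c : ℕ) (f : A → ℕ) → ∑ xs (λ x → c * f x) ≡ c * ∑ xs f
∑-*ˡ [] c f = sym (*-zeroʳ c)
∑-*ˡ (x ∷ xs) c f = trans (cong (c * f x +_) (∑-*ˡ xs c f)) (sym (*-distribˡ-+ c _ _))

∑-swap : (xs : List A) (ys : List B) (f : A → B → ℕ) →
  ∑ xs (λ x → ∑ ys (f x)) ≡ ∑ ys (λ y → ∑ xs (λ x → f x y))
∑-swap [] ys f = sym (∑-zero ys (λ _ → refl))
∑-swap (x ∷ xs) ys f = trans (cong (∑ ys (f x) +_) (∑-swap xs ys f)) (sym (∑-+ ys (f x) _))

∑-filter : (b : A → Bool) (xs : List A) (f : A → ℕ) →
  ∑ (filter (λ x → b x Data.Bool.≟ true) xs) f ≡ ∑ xs (λ x → if b x then f x else 0)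
∑-filter b [] f = refl
∑-filter b (x ∷ xs) f with b x
... | true  = cong (f x +_) (∑-filter b xs f)
... | false = ∑-filter b xs f

length-filter : (b : A → Bool) (xs : List A) →
  length (filter (λ x → b x Data.Bool.≟ true) xs) ≡ ∑ xs (λ x → ⟦ b x ⟧)
length-filter b [] = refl
length-filter b (x ∷ xs) with b x
... | true  = cong suc (length-filter b xs)
... | false = length-filter b xs

∑≤ : ℕ → (ℕ → ℕ) → ℕ
∑≤ zero    f = f 0
∑≤ (suc K) f = ∑≤ K f + f (suc K)

∑≤-unshift : ∀ K f → ∑≤ (suc K) f ≡ f 0 + ∑≤ K (f ∘ suc)
∑≤-unshift zero f = refl
∑≤-unshift (suc K) f = trans (cong (_+ f (suc (suc K))) (∑≤-unshift K f)) (+-assoc (f 0) _ _)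

∑≤-cong : ∀ K {f g} → (∀ i → f i ≡ g i) → ∑≤ K f ≡ ∑≤ K g
∑≤-cong zero e = e 0
∑≤-cong (suc K) e = cong₂ _+_ (∑≤-cong K e) (e (suc K))

∑≤-+ : ∀ K f g → ∑≤ K (λ i → f i + g i) ≡ ∑≤ K f + ∑≤ K g
∑≤-+ zero f g = refl
∑≤-+ (suc K) f g =
  trans (cong (_+ (f (suc K) + g (suc K))) (∑≤-+ K f g)) (+-interchange (∑≤ K f) (∑≤ K g) _ _)

∑≤-*ˡ : ∀ K c f → ∑≤ K (λ i → c * f i) ≡ c * ∑≤ K f
∑≤-*ˡ zero c f = refl
∑≤-*ˡ (suc K) c f = trans (cong (_+ c * f (suc K)) (∑≤-*ˡ K c f)) (sym (*-distribˡ-+ c _ _))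

∑≤-extend : ∀ K L f → K ≤ L → (∀ i → K < i → f i ≡ 0) → ∑≤ L f ≡ ∑≤ K f
∑≤-extend K zero f z≤n vanish = refl
∑≤-extend K (suc L) f K≤1+L vanish with m≤n⇒m<n∨m≡n K≤1+L
... | inj₂ refl = refl
... | inj₁ (s≤s K≤L) =
  trans (cong₂ _+_ (∑≤-extend K L f K≤L vanish) (vanish (suc L) (s≤s K≤L))) (+-identityʳ _)

∏ : List ℕ → (ℕ → ℕ) → ℕ
∏ xs f = product (map f xs)

∏-++ : ∀ xs ys f → ∏ (xs ++ ys) f ≡ ∏ xs f * ∏ ys f
∏-++ xs ys f = trans (cong product (map-++ f xs ys)) (product-++ (map f xs) (map f ys))

∏-cong : ∀ R {f g : ℕ → ℕ} → (∀ v → f v ≡ g v) → ∏ R f ≡ ∏ R g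
∏-cong []      e = refl
∏-cong (x ∷ R) e = cong₂ _*_ (e x) (∏-cong R e)

⟦all⟧ : ∀ (f : ℕ → Bool) R → ⟦ all f R ⟧ ≡ ∏ R (λ v → ⟦ f v ⟧)
⟦all⟧ f []      = refl
⟦all⟧ f (x ∷ R) = trans (⟦⟧-∧ (f x) (all f R)) (cong (⟦ f x ⟧ *_) (⟦all⟧ f R))

-- The binomial transform of the block recurrence

binom : ℕ → ℕ → ℕ
binom zero    zero    = 1
binom zero    (suc g) = 0
binom (suc a) zero    = 1
binom (suc a) (suc g) = binom a g + binom a (suc g)

binom-zeroʳ : ∀ a → binom a 0 ≡ 1
binom-zeroʳ zero    = refl
binom-zeroʳ (suc a) = refl

binom-vanish : ∀ a g → a < g → binom a g ≡ 0
binom-vanish zero    (suc g) _         = refl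
binom-vanish (suc a) (suc g) (s≤s a<g) =
  cong₂ _+_ (binom-vanish a g a<g) (binom-vanish a (suc g) (m<n⇒m<1+n a<g))

binom-absorb : ∀ a g → suc g * binom (suc a) (suc g) ≡ suc a * binom a g
binom-absorb zero zero = refl
binom-absorb zero (suc g) =
  trans (cong (suc (suc g) *_) (binom-vanish 0 (suc g) (s≤s z≤n))) (*-zeroʳ (suc (suc g)))
binom-absorb (suc a) zero = begin
  1 * (1 + binom (suc a) 1)    ≡⟨ cong (λ z → 1 * (1 + z)) (trans (sym (*-identityˡ _)) (binom-absorb a zero)) ⟩
  1 * (1 + suc a * binom a 0)  ≡⟨ cong (λ z → 1 * (1 + suc a * z)) (binom-zeroʳ a) ⟩
  1 * (1 + suc a * 1)          ≡⟨ normalise a ⟩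
  suc (suc a) * 1              ∎
  where
  normalise : ∀ a → 1 * (1 + suc a * 1) ≡ suc (suc a) * 1
  normalise = solve-∀
binom-absorb (suc a) (suc g) = begin
  suc (suc g) * (x + y)                           ≡⟨ split x y g ⟩
  x + suc g * x + suc (suc g) * y                 ≡⟨ cong₂ (λ u w → x + u + w) (binom-absorb a g) (binom-absorb a (suc g)) ⟩
  (x₀ + x₁) + suc a * x₀ + suc a * x₁             ≡⟨ merge x₀ x₁ a ⟩
  suc (suc a) * (x₀ + x₁)                         ∎
  where
  x y x₀ x₁ : ℕ
  x = binom (suc a) (suc g)
  y = binom (suc a) (suc (suc g))
  x₀ = binom a g
  x₁ = binom a (suc g)
  split : ∀ x y g → suc (suc g) * (x + y) ≡ x + suc g * x + suc (suc g) * y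
  split = solve-∀
  merge : ∀ x y a → (x + y) + suc a * x + suc a * y ≡ suc (suc a) * (x + y)
  merge = solve-∀

binom-lower : ∀ a g → suc g * binom a (suc g) + g * binom a g ≡ a * binom a g
binom-lower zero zero = refl
binom-lower zero (suc g) rewrite binom-vanish 0 (suc (suc g)) (s≤s z≤n) | binom-vanish 0 (suc g) (s≤s z≤n)
  = cong₂ _+_ (*-zeroʳ (suc (suc g))) (*-zeroʳ (suc g))
binom-lower (suc a) zero =
  trans (+-identityʳ _) (trans (binom-absorb a zero) (cong (suc a *_) (binom-zeroʳ a)))
binom-lower (suc a) (suc g) = begin
  suc (suc g) * binom (suc a) (suc (suc g)) + suc g * binom (suc a) (suc g)
    ≡⟨ cong₂ _+_ (binom-absorb a (suc g)) (binom-absorb a g) ⟩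
  suc a * binom a (suc g) + suc a * binom a g
    ≡⟨ factor (suc a) (binom a (suc g)) (binom a g) ⟩
  suc a * (binom a g + binom a (suc g)) ∎
  where
  factor : ∀ s x y → s * x + s * y ≡ s * (y + x)
  factor = solve-∀

binom-neighbours : ∀ a g →
  2 * a * binom a (suc g) + g * binom a g ≡ a * (binom (suc a) (suc g) + binom (a ∸ 1) (suc g))
binom-neighbours zero zero = refl
binom-neighbours zero (suc g) = *-zeroʳ (suc g)
binom-neighbours (suc a) g = begin
  2 * s * (x₀ + x₁) + g * y           ≡⟨ expand s x₀ x₁ g y ⟩
  (s * x₀ + g * y) + s * x₀ + 2 * s * x₁ ≡⟨ cong (λ z → z + s * x₀ + 2 * s * x₁) pascal-lower ⟩
  s * y + s * x₀ + 2 * s * x₁         ≡⟨ collect s x₀ x₁ y ⟩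
  s * ((y + (x₀ + x₁)) + x₁)          ∎
  where
  s x₀ x₁ y : ℕ
  s = suc a
  x₀ = binom a g
  x₁ = binom a (suc g)
  y = binom (suc a) g
  pascal-lower : s * x₀ + g * y ≡ s * y
  pascal-lower = trans (cong (_+ g * y) (sym (binom-absorb a g))) (binom-lower (suc a) g)
  expand : ∀ s x₀ x₁ g y → 2 * s * (x₀ + x₁) + g * y ≡ (s * x₀ + g * y) + s * x₀ + 2 * s * x₁
  expand = solve-∀
  collect : ∀ s x₀ x₁ y → s * y + s * x₀ + 2 * s * x₁ ≡ s * ((y + (x₀ + x₁)) + x₁)
  collect = solve-∀

binom₂ : ℕ → ℕ → ℕ
binom₂ a g = binom a g * 2 ^ g

binom₂-vanish : ∀ a g → a < g → binom₂ a g ≡ 0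
binom₂-vanish a g a<g = cong (_* 2 ^ g) (binom-vanish a g a<g)

binom₂-neighbours : ∀ a g f →
  2 * a * (binom₂ a (suc g) * f) + 2 * (binom₂ a g * (g * f))
    ≡ a * (binom₂ (suc a) (suc g) * f + binom₂ (a ∸ 1) (suc g) * f)
binom₂-neighbours a g f = begin
  2 * a * (binom₂ a (suc g) * f) + 2 * (binom₂ a g * (g * f))
    ≡⟨ regroup a (binom a (suc g)) (binom a g) (2 ^ g) f g ⟩
  2 * 2 ^ g * f * (2 * a * binom a (suc g) + g * binom a g)
    ≡⟨ cong (2 * 2 ^ g * f *_) (binom-neighbours a g) ⟩
  2 * 2 ^ g * f * (a * (binom (suc a) (suc g) + binom (a ∸ 1) (suc g)))
    ≡⟨ spread a (binom (suc a) (suc g)) (binom (a ∸ 1) (suc g)) (2 ^ g) f ⟩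
  a * (binom₂ (suc a) (suc g) * f + binom₂ (a ∸ 1) (suc g) * f) ∎
  where
  regroup : ∀ a b₁ b₀ p f g → 2 * a * (b₁ * (2 * p) * f) + 2 * (b₀ * p * (g * f)) ≡ 2 * p * f * (2 * a * b₁ + g * b₀)
  regroup = solve-∀
  spread : ∀ a x y p f → 2 * p * f * (a * (x + y)) ≡ a * (x * (2 * p) * f + y * (2 * p) * f)
  spread = solve-∀

transform : ℕ → (ℕ → ℕ) → ℕ
transform a φ = ∑≤ a (λ g → binom₂ a g * φ g)

transform-extend : ∀ a L φ → a ≤ L → ∑≤ L (λ g → binom₂ a g * φ g) ≡ transform a φ
transform-extend a L φ a≤L =
  ∑≤-extend a L _ a≤L (λ g a<g → cong (_* φ g) (binom₂-vanish a g a<g))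

transform-lower : ∀ a φ →
  ∑≤ (suc a) (λ g → binom₂ a g * (g * φ (g ∸ 1)) + binom₂ a g * (2 * g * φ g)) ≡ 2 * a * transform a φ
transform-lower a φ = begin
  ∑≤ (suc a) (λ g → down g + stay g)                  ≡⟨ ∑≤-+ (suc a) down stay ⟩
  ∑≤ (suc a) down + (∑≤ a stay + stay (suc a))        ≡⟨ cong₂ (λ x y → x + (∑≤ a stay + y)) (∑≤-unshift a down) stay-top ⟩
  (down 0 + ∑≤ a (down ∘ suc)) + (∑≤ a stay + 0)      ≡⟨ cong₂ (λ x y → (x + ∑≤ a (down ∘ suc)) + y) down-bottom (+-identityʳ _) ⟩
  ∑≤ a (down ∘ suc) + ∑≤ a stay                       ≡⟨ sym (∑≤-+ a (down ∘ suc) stay) ⟩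
  ∑≤ a (λ g → down (suc g) + stay g)                  ≡⟨ ∑≤-cong a pointwise ⟩
  ∑≤ a (λ g → 2 * a * (binom₂ a g * φ g))             ≡⟨ ∑≤-*ˡ a (2 * a) _ ⟩
  2 * a * transform a φ                               ∎
  where
  down stay : ℕ → ℕ
  down g = binom₂ a g * (g * φ (g ∸ 1))
  stay g = binom₂ a g * (2 * g * φ g)
  down-bottom : down 0 ≡ 0
  down-bottom = *-zeroʳ (binom₂ a 0)
  stay-top : stay (suc a) ≡ 0
  stay-top = cong (_* (2 * suc a * φ (suc a))) (binom₂-vanish a (suc a) (n<1+n a))
  regroup : ∀ b₁ b₀ p f g → b₁ * (2 * p) * (suc g * f) + b₀ * p * (2 * g * f) ≡ 2 * p * f * (suc g * b₁ + g * b₀)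
  regroup = solve-∀
  reorder : ∀ a b₀ p f → 2 * p * f * (a * b₀) ≡ 2 * a * (b₀ * p * f)
  reorder = solve-∀
  pointwise : ∀ g → down (suc g) + stay g ≡ 2 * a * (binom₂ a g * φ g)
  pointwise g = begin
    down (suc g) + stay g                                        ≡⟨ regroup (binom a (suc g)) (binom a g) (2 ^ g) (φ g) g ⟩
    2 * 2 ^ g * φ g * (suc g * binom a (suc g) + g * binom a g)  ≡⟨ cong (2 * 2 ^ g * φ g *_) (binom-lower a g) ⟩
    2 * 2 ^ g * φ g * (a * binom a g)                            ≡⟨ reorder a (binom a g) (2 ^ g) (φ g) ⟩
    2 * a * (binom₂ a g * φ g)                                   ∎

transform-raise : ∀ a φ →
  2 * a * transform a φ + 2 * ∑≤ (suc a) (λ g → binom₂ a g * (g * φ (suc g)))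
    ≡ a * (transform (suc a) φ + transform (a ∸ 1) φ)
transform-raise a φ = begin
  2 * a * transform a φ + 2 * ∑≤ (suc a) up
    ≡⟨ cong₂ _+_ (sym (∑≤-*ˡ a (2 * a) _)) (sym (∑≤-*ˡ (suc a) 2 up)) ⟩
  ∑≤ a stay + ∑≤ (suc a) (λ g → 2 * up g)
    ≡⟨ cong₂ _+_ (sym (∑≤-extend a (2 + a) stay (m≤n+m a 2) stay-vanish)) (sym (∑≤-unshift (suc a) shifted)) ⟩
  ∑≤ (2 + a) stay + ∑≤ (2 + a) shifted
    ≡⟨ sym (∑≤-+ (2 + a) stay shifted) ⟩
  ∑≤ (2 + a) (λ g → stay g + shifted g)
    ≡⟨ ∑≤-cong (2 + a) pointwise ⟩
  ∑≤ (2 + a) (λ g → a * (binom₂ (suc a) g * φ g + binom₂ (a ∸ 1) g * φ g))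
    ≡⟨ ∑≤-*ˡ (2 + a) a _ ⟩
  a * ∑≤ (2 + a) (λ g → binom₂ (suc a) g * φ g + binom₂ (a ∸ 1) g * φ g)
    ≡⟨ cong (a *_) (∑≤-+ (2 + a) _ _) ⟩
  a * (∑≤ (2 + a) (λ g → binom₂ (suc a) g * φ g) + ∑≤ (2 + a) (λ g → binom₂ (a ∸ 1) g * φ g))
    ≡⟨ cong (a *_) (cong₂ _+_ (transform-extend (suc a) (2 + a) φ (n≤1+n _))
                              (transform-extend (a ∸ 1) (2 + a) φ (≤-trans (m∸n≤m a 1) (m≤n+m a 2)))) ⟩
  a * (transform (suc a) φ + transform (a ∸ 1) φ) ∎
  where
  up stay shifted : ℕ → ℕ
  up g = binom₂ a g * (g * φ (suc g))
  stay g = 2 * a * (binom₂ a g * φ g)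
  shifted zero    = 0
  shifted (suc g) = 2 * up g
  stay-vanish : ∀ g → a < g → stay g ≡ 0
  stay-vanish g a<g = trans (cong (λ z → 2 * a * (z * φ g)) (binom₂-vanish a g a<g)) (*-zeroʳ (2 * a))
  doubled : ∀ a f → 2 * a * (1 * 1 * f) ≡ a * (1 * 1 * f + 1 * 1 * f)
  doubled = solve-∀
  pointwise : ∀ g → stay g + shifted g ≡ a * (binom₂ (suc a) g * φ g + binom₂ (a ∸ 1) g * φ g)
  pointwise zero rewrite binom-zeroʳ a | binom-zeroʳ (a ∸ 1) =
    trans (+-identityʳ _) (doubled a (φ 0))
  pointwise (suc g) = binom₂-neighbours a g (φ (suc g))

peakWeight : List ℕ → ℕ → ℕ
peakWeight P v = if elemᵇ v P then 2 else 0

-- The total weight of the ways to fill g blocks with the values 1, …, m (patternWeight≡fill).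
fill : List ℕ → ℕ → ℕ → ℕ
fill P zero    g = ⟦ g ≡ᵇ 0 ⟧
fill P (suc m) g = g * (fill P m (g ∸ 1) + 2 * fill P m g + peakWeight P (suc m) * fill P m (suc g))

fill⋆ : List ℕ → ℕ → ℕ → ℕ
fill⋆ P m a = transform a (fill P m)

fill⋆-one : ∀ P m → fill⋆ P (suc m) 1 ≡ 2 * fill P (suc m) 1
fill⋆-one P m = refl

fill⋆-zero : ∀ P a → fill⋆ P 0 a ≡ 1
fill⋆-zero P a = trans (∑≤-extend 0 a _ z≤n higher) (cong (λ x → x * 1 * 1) (binom-zeroʳ a))
  where
  higher : ∀ g → 0 < g → binom₂ a g * fill P 0 g ≡ 0
  higher (suc g) _ = *-zeroʳ (binom₂ a (suc g))

fill⋆-suc : ∀ P m a → fill⋆ P (suc m) a ≡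
  (if elemᵇ (suc m) P then a * (fill⋆ P m (suc a) + fill⋆ P m (a ∸ 1)) else 2 * a * fill⋆ P m a)
fill⋆-suc P m a = begin
  fill⋆ P (suc m) a
    ≡⟨ sym (transform-extend a (suc a) (fill P (suc m)) (n≤1+n a)) ⟩
  ∑≤ (suc a) (λ g → binom₂ a g * fill P (suc m) g)
    ≡⟨ ∑≤-cong (suc a) (λ g → distribute (binom₂ a g) g (φ (g ∸ 1)) (φ g) c (φ (suc g))) ⟩
  ∑≤ (suc a) (λ g → lower g + c * up g)
    ≡⟨ ∑≤-+ (suc a) lower (λ g → c * up g) ⟩
  ∑≤ (suc a) lower + ∑≤ (suc a) (λ g → c * up g)
    ≡⟨ cong₂ _+_ (transform-lower a φ) (∑≤-*ˡ (suc a) c up) ⟩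
  2 * a * fill⋆ P m a + c * ∑≤ (suc a) up
    ≡⟨ by-membership ⟩
  (if elemᵇ (suc m) P then a * (fill⋆ P m (suc a) + fill⋆ P m (a ∸ 1)) else 2 * a * fill⋆ P m a) ∎
  where
  φ : ℕ → ℕ
  c : ℕ
  φ = fill P m
  c = peakWeight P (suc m)
  lower up : ℕ → ℕ
  lower g = binom₂ a g * (g * φ (g ∸ 1)) + binom₂ a g * (2 * g * φ g)
  up g = binom₂ a g * (g * φ (suc g))
  distribute : ∀ e g x y c z → e * (g * (x + 2 * y + c * z)) ≡ (e * (g * x) + e * (2 * g * y)) + c * (e * (g * z))
  distribute = solve-∀
  by-membership : 2 * a * fill⋆ P m a + c * ∑≤ (suc a) up ≡
    (if elemᵇ (suc m) P then a * (fill⋆ P m (suc a) + fill⋆ P m (a ∸ 1)) else 2 * a * fill⋆ P m a)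
  by-membership with elemᵇ (suc m) P
  ... | true  = transform-raise a φ
  ... | false = +-identityʳ _

-- Unfolding the height recurrence into walks

elemᵇ-above : ∀ {b} L → All (_< b) L → ∀ i → b ≤ i → elemᵇ i L ≡ false
elemᵇ-above [] [] i b≤i = refl
elemᵇ-above (x ∷ L) (x<b ∷ L<b) i b≤i
  rewrite ≢⇒≡ᵇ-false i x (λ i≡x → <-irrefl (sym i≡x) (<-≤-trans x<b b≤i)) = elemᵇ-above L L<b i b≤i

strictDec-tail : ∀ {x xs} → StrictDec (x ∷ xs) → StrictDec xs
strictDec-tail [ x ]    = []
strictDec-tail (_ ∷ sd) = sd

strictDec-below : ∀ {x xs} → StrictDec (x ∷ xs) → All (_< x) xs
strictDec-below [ x ]      = []
strictDec-below (y<x ∷ sd) = y<x ∷ All.map (λ z<y → <-trans z<y y<x) (strictDec-below sd)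

strictDec-length : ∀ L b → StrictDec L → All (1 ≤_) L → All (_≤ b) L → length L ≤ b
strictDec-length [] b _ _ _ = z≤n
strictDec-length (suc x ∷ xs) b sd (_ ∷ xs≥1) (x<b ∷ _) =
  ≤-trans (s≤s (strictDec-length xs x (strictDec-tail sd) xs≥1 (All.map ≤-pred (strictDec-below sd)))) x<b

H : List ℕ → ℕ → ℤ → ℤ
H P zero    x = ℤ.1ℤ
H P (suc m) x =
  if elemᵇ (suc m) P
  then x ℤ.* (H P m (x ℤ.+ ℤ.1ℤ) ℤ.+ H P m (x ℤ.- ℤ.1ℤ))
  else ℤ.+ 2 ℤ.* x ℤ.* H P m x

fill⋆≡H : ∀ P m a → ℤ.+ fill⋆ P m a ≡ H P m (ℤ.+ a)
fill⋆≡H P zero a = cong ℤ.+_ (fill⋆-zero P a)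
fill⋆≡H P (suc m) a rewrite fill⋆-suc P m a with elemᵇ (suc m) P
... | false = begin
  ℤ.+ (2 * a * fill⋆ P m a)             ≡⟨ ℤ.pos-* (2 * a) _ ⟩
  ℤ.+ (2 * a) ℤ.* ℤ.+ fill⋆ P m a       ≡⟨ cong₂ ℤ._*_ (ℤ.pos-* 2 a) (fill⋆≡H P m a) ⟩
  ℤ.+ 2 ℤ.* ℤ.+ a ℤ.* H P m (ℤ.+ a)     ∎
... | true with a
...   | zero  = refl
...   | suc b = begin
  ℤ.+ (suc b * (fill⋆ P m (2 + b) + fill⋆ P m b))
    ≡⟨ ℤ.pos-* (suc b) _ ⟩
  ℤ.+ suc b ℤ.* ℤ.+ (fill⋆ P m (2 + b) + fill⋆ P m b)
    ≡⟨ cong (ℤ.+ suc b ℤ.*_) (ℤ.pos-+ (fill⋆ P m (2 + b)) _) ⟩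
  ℤ.+ suc b ℤ.* (ℤ.+ fill⋆ P m (2 + b) ℤ.+ ℤ.+ fill⋆ P m b)
    ≡⟨ cong (ℤ.+ suc b ℤ.*_) (cong₂ ℤ._+_ (fill⋆≡H P m (2 + b)) (fill⋆≡H P m b)) ⟩
  ℤ.+ suc b ℤ.* (H P m (ℤ.+ (2 + b)) ℤ.+ H P m (ℤ.+ b))
    ≡⟨ cong (λ z → ℤ.+ suc b ℤ.* (H P m (ℤ.+ z) ℤ.+ H P m (ℤ.+ b))) (cong suc (+-comm 1 b)) ⟩
  ℤ.+ suc b ℤ.* (H P m (ℤ.+ suc b ℤ.+ ℤ.1ℤ) ℤ.+ H P m (ℤ.+ suc b ℤ.- ℤ.1ℤ)) ∎

pos-^ : ∀ m j → ℤ.+ (m ^ j) ≡ (ℤ.+ m) ℤ.^ j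
pos-^ m zero    = refl
pos-^ m (suc j) = trans (ℤ.pos-* m (m ^ j)) (cong (ℤ.+ m ℤ.*_) (pos-^ m j))

^-distribʳ-* : ∀ x y j → (x ℤ.* y) ℤ.^ j ≡ x ℤ.^ j ℤ.* y ℤ.^ j
^-distribʳ-* x y zero    = refl
^-distribʳ-* x y (suc j) = trans (cong (x ℤ.* y ℤ.*_) (^-distribʳ-* x y j)) (interchange x y (x ℤ.^ j) (y ℤ.^ j))
  where
  interchange : ∀ x y a b → x ℤ.* y ℤ.* (a ℤ.* b) ≡ x ℤ.* a ℤ.* (y ℤ.* b)
  interchange = ℤ.solve-∀

H-[] : ∀ t x → H [] t x ≡ (ℤ.+ 2 ℤ.* x) ℤ.^ t
H-[] zero    x = refl
H-[] (suc t) x = cong (ℤ.+ 2 ℤ.* x ℤ.*_) (H-[] t x)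

H-drop : ∀ p P m x → m < p → H (p ∷ P) m x ≡ H P m x
H-drop p P zero    x _ = refl
H-drop p P (suc m) x m<p rewrite ≢⇒≡ᵇ-false (suc m) p (λ m≡p → <-irrefl m≡p m<p)
  with elemᵇ (suc m) P
... | true  = cong (x ℤ.*_) (cong₂ ℤ._+_ (H-drop p P m _ (<-trans (n<1+n m) m<p)) (H-drop p P m _ (<-trans (n<1+n m) m<p)))
... | false = cong (ℤ.+ 2 ℤ.* x ℤ.*_) (H-drop p P m x (<-trans (n<1+n m) m<p))

H-stretch : ∀ P p j x → (∀ i → p < i → elemᵇ i P ≡ false) → H P (j + p) x ≡ (ℤ.+ 2 ℤ.* x) ℤ.^ j ℤ.* H P p x
H-stretch P p zero    x _ = sym (ℤ.*-identityˡ _)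
H-stretch P p (suc j) x above rewrite above (suc (j + p)) (s≤s (m≤n+m p j)) =
  trans (cong (ℤ.+ 2 ℤ.* x ℤ.*_) (H-stretch P p j x above)) (sym (ℤ.*-assoc (ℤ.+ 2 ℤ.* x) _ _))

sumℤ-++ : ∀ xs ys → sumℤ (xs ++ ys) ≡ sumℤ xs ℤ.+ sumℤ ys
sumℤ-++ []       ys = sym (ℤ.+-identityˡ _)
sumℤ-++ (x ∷ xs) ys = trans (cong (ℤ._+_ x) (sumℤ-++ xs ys)) (sym (ℤ.+-assoc x _ _))

sumℤ-*ˡ : (g : A → ℤ) (c : ℤ) (xs : List A) → sumℤ (map (λ x → c ℤ.* g x) xs) ≡ c ℤ.* sumℤ (map g xs)
sumℤ-*ˡ g c []       = sym (ℤ.*-zeroʳ c)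
sumℤ-*ˡ g c (x ∷ xs) = trans (cong (ℤ._+_ (c ℤ.* g x)) (sumℤ-*ˡ g c xs)) (sym (ℤ.*-distribˡ-+ c _ _))

walkSum : ℕ → List ℕ → ℤ → ℤ
walkSum t P h = sumℤ (map (λ w → prodPow w (diffs (pSeq t P))) (walksFrom h (length P)))

walkSum-cons : ∀ t p P h → walkSum t (suc p ∷ P) h ≡
  (h ℤ.+ ℤ.1ℤ) ℤ.^ (suc t ∸ suc p) ℤ.* (walkSum p P (h ℤ.+ ℤ.1ℤ) ℤ.+ walkSum p P (h ℤ.- ℤ.1ℤ))
walkSum-cons t p P h = begin
  sumℤ (map f (map (h ∷_) ups ++ map (h ∷_) downs))
    ≡⟨ cong sumℤ (map-++ f (map (h ∷_) ups) _) ⟩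
  sumℤ (map f (map (h ∷_) ups) ++ map f (map (h ∷_) downs))
    ≡⟨ sumℤ-++ (map f (map (h ∷_) ups)) _ ⟩
  sumℤ (map f (map (h ∷_) ups)) ℤ.+ sumℤ (map f (map (h ∷_) downs))
    ≡⟨ cong₂ ℤ._+_ (cong sumℤ (sym (map-∘ ups))) (cong sumℤ (sym (map-∘ downs))) ⟩
  sumℤ (map (λ w → c ℤ.* g w) ups) ℤ.+ sumℤ (map (λ w → c ℤ.* g w) downs)
    ≡⟨ cong₂ ℤ._+_ (sumℤ-*ˡ g c ups) (sumℤ-*ˡ g c downs) ⟩
  c ℤ.* walkSum p P (h ℤ.+ ℤ.1ℤ) ℤ.+ c ℤ.* walkSum p P (h ℤ.- ℤ.1ℤ)
    ≡⟨ sym (ℤ.*-distribˡ-+ c _ _) ⟩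
  c ℤ.* (walkSum p P (h ℤ.+ ℤ.1ℤ) ℤ.+ walkSum p P (h ℤ.- ℤ.1ℤ)) ∎
  where
  f g : List ℤ → ℤ
  f w = prodPow w (diffs (pSeq t (suc p ∷ P)))
  g w = prodPow w (diffs (pSeq p P))
  c : ℤ
  ups downs : List (List ℤ)
  c = (h ℤ.+ ℤ.1ℤ) ℤ.^ (suc t ∸ suc p)
  ups = walksFrom (h ℤ.+ ℤ.1ℤ) (length P)
  downs = walksFrom (h ℤ.- ℤ.1ℤ) (length P)

H-peak : ∀ p P x → StrictDec (suc p ∷ P) →
  H (suc p ∷ P) (suc p) x ≡ x ℤ.* (H P p (x ℤ.+ ℤ.1ℤ) ℤ.+ H P p (x ℤ.- ℤ.1ℤ))
H-peak p P x sd rewrite ≡ᵇ-refl p =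
  cong (x ℤ.*_) (cong₂ ℤ._+_ (H-drop (suc p) P p _ (n<1+n p)) (H-drop (suc p) P p _ (n<1+n p)))

H-above-peak : ∀ p P h j → StrictDec (suc p ∷ P) → length P ≤ p →
  H (suc p ∷ P) (suc p) (h ℤ.+ ℤ.1ℤ) ≡
    (h ℤ.+ ℤ.1ℤ) ℤ.* (ℤ.+ (2 ^ (p ∸ length P)) ℤ.* walkSum p P (h ℤ.+ ℤ.1ℤ) ℤ.+ ℤ.+ (2 ^ (p ∸ length P)) ℤ.* walkSum p P (h ℤ.- ℤ.1ℤ)) →
  H (suc p ∷ P) (j + suc p) (h ℤ.+ ℤ.1ℤ) ≡ ℤ.+ (2 ^ (j + suc p ∸ suc (length P))) ℤ.* walkSum (j + suc p) (suc p ∷ P) h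
H-above-peak p P h j sd k≤p peak = begin
  H (suc p ∷ P) (j + suc p) x
    ≡⟨ H-stretch (suc p ∷ P) (suc p) j x (λ i p<i → elemᵇ-above (suc p ∷ P) (n<1+n _ ∷ All.map m<n⇒m<1+n (strictDec-below sd)) i p<i) ⟩
  (ℤ.+ 2 ℤ.* x) ℤ.^ j ℤ.* H (suc p ∷ P) (suc p) x
    ≡⟨ cong₂ ℤ._*_ (^-distribʳ-* (ℤ.+ 2) x j) peak ⟩
  (ℤ.+ 2) ℤ.^ j ℤ.* x ℤ.^ j ℤ.* (x ℤ.* (ℤ.+ (2 ^ e) ℤ.* W₊ ℤ.+ ℤ.+ (2 ^ e) ℤ.* W₋))
    ≡⟨ cong (λ z → (ℤ.+ 2) ℤ.^ j ℤ.* x ℤ.^ j ℤ.* (x ℤ.* (z ℤ.* W₊ ℤ.+ z ℤ.* W₋))) (pos-^ 2 e) ⟩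
  (ℤ.+ 2) ℤ.^ j ℤ.* x ℤ.^ j ℤ.* (x ℤ.* ((ℤ.+ 2) ℤ.^ e ℤ.* W₊ ℤ.+ (ℤ.+ 2) ℤ.^ e ℤ.* W₋))
    ≡⟨ regroup ((ℤ.+ 2) ℤ.^ j) (x ℤ.^ j) ((ℤ.+ 2) ℤ.^ e) x W₊ W₋ ⟩
  (ℤ.+ 2) ℤ.^ j ℤ.* (ℤ.+ 2) ℤ.^ e ℤ.* (x ℤ.^ suc j ℤ.* (W₊ ℤ.+ W₋))
    ≡⟨ cong₂ ℤ._*_ (trans (sym (ℤ.^-distribˡ-+-* (ℤ.+ 2) j e)) (sym (pos-^ 2 (j + e))))
                   (cong (λ z → x ℤ.^ z ℤ.* (W₊ ℤ.+ W₋)) (sym (m+n∸n≡m (suc j) p))) ⟩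
  ℤ.+ (2 ^ (j + e)) ℤ.* (x ℤ.^ (suc j + p ∸ p) ℤ.* (W₊ ℤ.+ W₋))
    ≡⟨ cong₂ (λ u v → ℤ.+ (2 ^ u) ℤ.* (x ℤ.^ (v ∸ p) ℤ.* (W₊ ℤ.+ W₋)))
             (sym (+-∸-assoc j (s≤s k≤p))) (sym (+-suc j p)) ⟩
  ℤ.+ (2 ^ (j + suc p ∸ suc k)) ℤ.* (x ℤ.^ (suc (j + suc p) ∸ suc p) ℤ.* (W₊ ℤ.+ W₋))
    ≡⟨ cong (ℤ.+ (2 ^ (j + suc p ∸ suc k)) ℤ.*_) (sym (walkSum-cons (j + suc p) p P h)) ⟩
  ℤ.+ (2 ^ (j + suc p ∸ suc k)) ℤ.* walkSum (j + suc p) (suc p ∷ P) h ∎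
  where
  x W₊ W₋ : ℤ
  x = h ℤ.+ ℤ.1ℤ
  W₊ = walkSum p P (h ℤ.+ ℤ.1ℤ)
  W₋ = walkSum p P (h ℤ.- ℤ.1ℤ)
  k e : ℕ
  k = length P
  e = p ∸ k
  regroup : ∀ a b c y u v → a ℤ.* b ℤ.* (y ℤ.* (c ℤ.* u ℤ.+ c ℤ.* v)) ≡ a ℤ.* c ℤ.* (y ℤ.* b ℤ.* (u ℤ.+ v))
  regroup = ℤ.solve-∀

H≡walkSum : ∀ P t h → StrictDec P → All (1 ≤_) P → All (_≤ t) P →
  H P t (h ℤ.+ ℤ.1ℤ) ≡ ℤ.+ (2 ^ (t ∸ length P)) ℤ.* walkSum t P h
H≡walkSum [] t h _ _ _ = begin
  H [] t x                                    ≡⟨ H-[] t x ⟩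
  (ℤ.+ 2 ℤ.* x) ℤ.^ t                         ≡⟨ ^-distribʳ-* (ℤ.+ 2) x t ⟩
  (ℤ.+ 2) ℤ.^ t ℤ.* x ℤ.^ t                     ≡⟨ cong₂ ℤ._*_ (sym (pos-^ 2 t)) (unit (x ℤ.^ t)) ⟩
  ℤ.+ (2 ^ t) ℤ.* (x ℤ.^ t ℤ.* ℤ.1ℤ ℤ.+ ℤ.0ℤ) ∎
  where
  x : ℤ
  x = h ℤ.+ ℤ.1ℤ
  unit : ∀ y → y ≡ y ℤ.* ℤ.1ℤ ℤ.+ ℤ.0ℤ
  unit = ℤ.solve-∀
H≡walkSum (suc p ∷ P) t h sd (_ ∷ P≥1) (p<t ∷ _) =
  subst (λ t → H (suc p ∷ P) t x ≡ ℤ.+ (2 ^ (t ∸ suc k)) ℤ.* walkSum t (suc p ∷ P) h)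
        (m∸n+n≡m p<t) (H-above-peak p P h (t ∸ suc p) sd k≤p peak)
  where
  x : ℤ
  x = h ℤ.+ ℤ.1ℤ
  k : ℕ
  k = length P
  P≤p : All (_≤ p) P
  P≤p = All.map ≤-pred (strictDec-below sd)
  k≤p : k ≤ p
  k≤p = strictDec-length P p (strictDec-tail sd) P≥1 P≤p
  shift : ∀ h → h ℤ.+ ℤ.1ℤ ℤ.- ℤ.1ℤ ≡ h ℤ.- ℤ.1ℤ ℤ.+ ℤ.1ℤ
  shift = ℤ.solve-∀
  peak : H (suc p ∷ P) (suc p) x ≡
    x ℤ.* (ℤ.+ (2 ^ (p ∸ k)) ℤ.* walkSum p P (h ℤ.+ ℤ.1ℤ) ℤ.+ ℤ.+ (2 ^ (p ∸ k)) ℤ.* walkSum p P (h ℤ.- ℤ.1ℤ))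
  peak = trans (H-peak p P x sd) (cong (x ℤ.*_) (cong₂ ℤ._+_
    (H≡walkSum P p (h ℤ.+ ℤ.1ℤ) (strictDec-tail sd) P≥1 P≤p)
    (trans (cong (H P p) (shift h)) (H≡walkSum P p (h ℤ.- ℤ.1ℤ) (strictDec-tail sd) P≥1 P≤p))))

-- Permutations as words

count : ℕ → List ℕ → ℕ
count y xs = ∑ xs (λ x → ⟦ y ≡ᵇ x ⟧)

inRange : ℕ → ℕ → Bool
inRange n y = (0 <ᵇ y) ∧ (y <ᵇ suc n)

range1-suc : ∀ n → range1 (suc n) ≡ range1 n ++ (suc n ∷ [])
range1-suc n = trans (cong (map suc) (sym (upTo-∷ʳ n))) (map-++ suc (upTo n) (n ∷ []))

length-range1 : ∀ n → length (range1 n) ≡ n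
length-range1 n = trans (length-map suc (upTo n)) (length-upTo n)

count-range1 : ∀ n y → count y (range1 n) ≡ ⟦ inRange n y ⟧
count-range1 zero    zero    = refl
count-range1 zero    (suc y) = refl
count-range1 (suc n) y = begin
  count y (range1 (suc n))                      ≡⟨ cong (count y) (range1-suc n) ⟩
  count y (range1 n ++ suc n ∷ [])              ≡⟨ ∑-++ (range1 n) (suc n ∷ []) _ ⟩
  count y (range1 n) + (⟦ y ≡ᵇ suc n ⟧ + 0)     ≡⟨ cong₂ _+_ (count-range1 n y) (+-identityʳ _) ⟩
  ⟦ inRange n y ⟧ + ⟦ y ≡ᵇ suc n ⟧              ≡⟨ last y ⟩
  ⟦ inRange (suc n) y ⟧                         ∎
  where
  last : ∀ y → ⟦ inRange n y ⟧ + ⟦ y ≡ᵇ suc n ⟧ ≡ ⟦ inRange (suc n) y ⟧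
  last zero    = refl
  last (suc y) = ⟦<ᵇ-suc⟧ y n

inRange-range1 : ∀ n → All (λ y → inRange n y ≡ true) (range1 n)
inRange-range1 zero = []
inRange-range1 (suc n) rewrite range1-suc n =
  All.++⁺ (All.map (λ {y} → widen y) (inRange-range1 n)) (<ᵇ-suc-refl n ∷ [])
  where
  widen : ∀ y → inRange n y ≡ true → inRange (suc n) y ≡ true
  widen (suc y) y<n = <ᵇ-weaken y n y<n

InRange : ℕ → List ℕ → Set
InRange n = All (λ y → inRange n y ≡ true)

words-shape : ∀ n l → All (λ w → length w ≡ l × InRange n w) (words n l)
words-shape n zero    = (refl , []) ∷ []
words-shape n (suc l) = All.concat⁺ (All.map⁺ (All.map prepend (inRange-range1 n)))
  where
  prepend : ∀ {a} → inRange n a ≡ true → All (λ w → length w ≡ suc l × InRange n w) (map (a ∷_) (words n l))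
  prepend a∈ = All.map⁺ (All.map (λ { (len , w∈) → cong suc len , a∈ ∷ w∈ }) (words-shape n l))

words-count : ∀ n l q → length q ≡ l → InRange n q → ∑ (words n l) (λ w → ⟦ w == q ⟧) ≡ 1
words-count n zero    []      _   _           = refl
words-count n (suc l) (x ∷ q) len (x∈ ∷ q∈) = begin
  ∑ (concatMap (λ a → map (a ∷_) (words n l)) (range1 n)) (λ w → ⟦ w == x ∷ q ⟧)
    ≡⟨ ∑-concatMap _ (range1 n) _ ⟩
  ∑ (range1 n) (λ a → ∑ (map (a ∷_) (words n l)) (λ w → ⟦ w == x ∷ q ⟧))
    ≡⟨ ∑-cong (range1 n) (λ a → ∑-map (a ∷_) (words n l) _) ⟩
  ∑ (range1 n) (λ a → ∑ (words n l) (λ w → ⟦ (a ≡ᵇ x) ∧ (w == q) ⟧))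
    ≡⟨ ∑-cong (range1 n) (λ a → trans (∑-cong (words n l) (λ w → ⟦⟧-∧ (a ≡ᵇ x) (w == q))) (∑-*ˡ (words n l) ⟦ a ≡ᵇ x ⟧ _)) ⟩
  ∑ (range1 n) (λ a → ⟦ a ≡ᵇ x ⟧ * ∑ (words n l) (λ w → ⟦ w == q ⟧))
    ≡⟨ ∑-cong (range1 n) (λ a → cong₂ _*_ (cong ⟦_⟧ (≡ᵇ-sym a x)) (words-count n l q (suc-injective len) q∈)) ⟩
  ∑ (range1 n) (λ a → ⟦ x ≡ᵇ a ⟧ * 1)
    ≡⟨ ∑-cong (range1 n) (λ a → *-identityʳ _) ⟩
  count x (range1 n)
    ≡⟨ trans (count-range1 n x) (cong ⟦_⟧ x∈) ⟩
  1 ∎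

count-≡0⇔elemᵇ-false : ∀ x xs → (count x xs ≡ 0 → elemᵇ x xs ≡ false) × (elemᵇ x xs ≡ false → count x xs ≡ 0)
count-≡0⇔elemᵇ-false x [] = (λ _ → refl) , (λ _ → refl)
count-≡0⇔elemᵇ-false x (y ∷ xs) with x ≡ᵇ y
... | true  = (λ ()) , (λ ())
... | false = count-≡0⇔elemᵇ-false x xs

distinct⇒count≤1 : ∀ π → distinctᵇ π ≡ true → ∀ y → count y π ≤ 1
distinct⇒count≤1 []       _ y = z≤n
distinct⇒count≤1 (x ∷ xs) d y with elemᵇ x xs in x∈xs | distinctᵇ xs in dxs | y ≡ᵇ x in y≡ᵇx
... | false | true | false = distinct⇒count≤1 xs dxs y
... | false | true | true rewrite ≡ᵇ-true⇒≡ y x y≡ᵇx | proj₂ (count-≡0⇔elemᵇ-false x xs) x∈xs = s≤s z≤n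

count≤1⇒distinct : ∀ π → (∀ y → count y π ≤ 1) → distinctᵇ π ≡ true
count≤1⇒distinct []       _       = refl
count≤1⇒distinct (x ∷ xs) count≤1 =
  trans (cong (λ b → not b ∧ distinctᵇ xs) (proj₁ (count-≡0⇔elemᵇ-false x xs) x∉xs))
        (count≤1⇒distinct xs (λ y → ≤-trans (m≤n+m (count y xs) ⟦ y ≡ᵇ x ⟧) (count≤1 y)))
  where
  x∉xs : count x xs ≡ 0
  x∉xs with count≤1 x
  ... | bound rewrite ≡ᵇ-refl x = n≤0⇒n≡0 (≤-pred bound)

∑-count : ∀ n π → InRange n π → ∑ (range1 n) (λ y → count y π) ≡ length π
∑-count n π π∈ = trans (∑-swap (range1 n) π (λ y x → ⟦ y ≡ᵇ x ⟧)) (once π π∈)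
  where
  once : ∀ π → InRange n π → ∑ π (λ x → ∑ (range1 n) (λ y → ⟦ y ≡ᵇ x ⟧)) ≡ length π
  once []      []        = refl
  once (x ∷ π) (x∈ ∷ π∈) = cong₂ _+_
    (trans (∑-cong (range1 n) (λ y → cong ⟦_⟧ (≡ᵇ-sym y x))) (trans (count-range1 n x) (cong ⟦_⟧ x∈)))
    (once π π∈)

∑≤length : ∀ R (f : ℕ → ℕ) → (∀ y → f y ≤ 1) → ∑ R f ≤ length R
∑≤length []      f f≤1 = z≤n
∑≤length (x ∷ R) f f≤1 = +-mono-≤ (f≤1 x) (∑≤length R f f≤1)

∑≡length-head : ∀ x R (f : ℕ → ℕ) → (∀ y → f y ≤ 1) → ∑ (x ∷ R) f ≡ length (x ∷ R) →
  f x ≡ 1 × ∑ R f ≡ length R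
∑≡length-head x R f f≤1 full with f x | f≤1 x
... | 0 | _ = ⊥-elim (<-irrefl full (s≤s (∑≤length R f f≤1)))
... | 1 | _ = refl , suc-injective full
... | suc (suc _) | s≤s ()

pigeonhole : ∀ R (f : ℕ → ℕ) → (∀ y → f y ≤ 1) → ∑ R f ≡ length R → ∀ y → 1 ≤ count y R → f y ≡ 1
pigeonhole (x ∷ R) f f≤1 full y y∈ with y ≡ᵇ x in y≡ᵇx
... | true rewrite ≡ᵇ-true⇒≡ y x y≡ᵇx = proj₁ (∑≡length-head x R f f≤1 full)
... | false = pigeonhole R f f≤1 (proj₂ (∑≡length-head x R f f≤1 full)) y y∈

Permutation : ℕ → List ℕ → Set
Permutation n π = InRange n π × (∀ y → inRange n y ≡ true → count y π ≡ 1) × length π ≡ n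

Sn-permutation : ∀ n → All (Permutation n) (Sn n)
Sn-permutation n =
  All.map permutation (All.zip (All.filter⁺ distinct? (words-shape n n) , All.all-filter distinct? (words n n)))
  where
  distinct? : Decidable (λ w → distinctᵇ w ≡ true)
  distinct? w = distinctᵇ w Data.Bool.≟ true
  permutation : ∀ {π} → (length π ≡ n × InRange n π) × distinctᵇ π ≡ true → Permutation n π
  permutation {π} ((len , π∈) , distinct) = π∈ , once , len
    where
    count≤1 : ∀ y → count y π ≤ 1
    count≤1 = distinct⇒count≤1 π distinct
    filled : ∑ (range1 n) (λ y → count y π) ≡ length (range1 n)
    filled = trans (∑-count n π π∈) (trans len (sym (length-range1 n)))
    once : ∀ y → inRange n y ≡ true → count y π ≡ 1
    once y y∈ = pigeonhole (range1 n) (λ y → count y π) count≤1 filled y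
      (≤-reflexive (sym (trans (count-range1 n y) (cong ⟦_⟧ y∈))))

count-self : ∀ q → All (λ x → 1 ≤ count x q) q
count-self []      = []
count-self (x ∷ q) =
  subst (λ b → 1 ≤ ⟦ b ⟧ + count x q) (sym (≡ᵇ-refl x)) (s≤s z≤n)
  ∷ All.map (λ {y} y∈q → ≤-trans y∈q (m≤n+m (count y q) ⟦ y ≡ᵇ x ⟧)) (count-self q)

matching-permutation : ∀ n q → (∀ y → count y q ≡ ⟦ inRange n y ⟧) → ∑ (Sn n) (λ π → ⟦ π == q ⟧) ≡ 1
matching-permutation n q counts = begin
  ∑ (Sn n) (λ π → ⟦ π == q ⟧)                                  ≡⟨ ∑-filter distinctᵇ (words n n) _ ⟩
  ∑ (words n n) (λ w → if distinctᵇ w then ⟦ w == q ⟧ else 0)  ≡⟨ ∑-cong (words n n) only-q ⟩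
  ∑ (words n n) (λ w → ⟦ w == q ⟧)                             ≡⟨ words-count n n q len q∈ ⟩
  1                                                            ∎
  where
  q∈ : InRange n q
  q∈ = All.map (λ {x} x∈q → ⟦⟧-pos (inRange n x) (subst (1 ≤_) (counts x) x∈q)) (count-self q)
    where
    ⟦⟧-pos : ∀ b → 1 ≤ ⟦ b ⟧ → b ≡ true
    ⟦⟧-pos true _ = refl
  len : length q ≡ n
  len = begin
    length q                                ≡⟨ sym (∑-count n q q∈) ⟩
    ∑ (range1 n) (λ y → count y q)          ≡⟨ ∑-cong (range1 n) (λ y → trans (counts y) (sym (count-range1 n y))) ⟩
    ∑ (range1 n) (λ y → count y (range1 n)) ≡⟨ ∑-count n (range1 n) (inRange-range1 n) ⟩
    length (range1 n)                       ≡⟨ length-range1 n ⟩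
    n                                       ∎
  q-distinct : distinctᵇ q ≡ true
  q-distinct = count≤1⇒distinct q (λ y → subst (_≤ 1) (sym (counts y)) (⟦⟧≤1 (inRange n y)))
  only-q : ∀ w → (if distinctᵇ w then ⟦ w == q ⟧ else 0) ≡ ⟦ w == q ⟧
  only-q w with w == q in w≡q
  ... | true rewrite ==-true⇒≡ w q w≡q | q-distinct = refl
  ... | false with distinctᵇ w
  ...   | true  = refl
  ...   | false = refl

count-zero-permutation : ∀ n π → InRange n π → count 0 π ≡ 0
count-zero-permutation n []      []        = refl
count-zero-permutation n (suc x ∷ π) (_ ∷ π∈) = count-zero-permutation n π π∈

inRange-intro : ∀ {n p} → 1 ≤ p → p ≤ n → inRange n p ≡ true
inRange-intro {p = suc p} _ p<n = Equivalence.to T-≡ (<⇒<ᵇ p<n)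

-- In a block pattern at threshold v, each maximal run of letters below v is replaced by one 0.
block∷ : List ℕ → List ℕ
block∷ []           = 0 ∷ []
block∷ (zero ∷ ys)  = zero ∷ ys
block∷ (suc y ∷ ys) = 0 ∷ suc y ∷ ys

compress : ℕ → List ℕ → List ℕ
compress v []       = []
compress v (x ∷ xs) = if x <ᵇ v then block∷ (compress v xs) else x ∷ compress v xs

absorb : ℕ → List ℕ → List ℕ
absorb v []           = []
absorb v (zero ∷ xs)  = block∷ (absorb v xs)
absorb v (suc x ∷ xs) = if v ≡ᵇ suc x then block∷ (absorb v xs) else suc x ∷ absorb v xs

-- v enters exactly one block of the pattern: alone, at either end, or strictly inside it.
expand : ℕ → List ℕ → List (List ℕ)
expand v []             = []
expand v (zero ∷ rest)  =
  (v ∷ rest) ∷ (v ∷ 0 ∷ rest) ∷ (0 ∷ v ∷ rest) ∷ (0 ∷ v ∷ 0 ∷ rest) ∷ map (0 ∷_) (expand v rest)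
expand v (suc x ∷ rest) = map (suc x ∷_) (expand v rest)

Separated : List ℕ → Set
Separated []                 = ⊤
Separated (zero ∷ [])        = ⊤
Separated (zero ∷ zero ∷ _)  = ⊥
Separated (zero ∷ suc y ∷ r) = Separated (suc y ∷ r)
Separated (suc x ∷ r)        = Separated r

NoLeadingBlock : List ℕ → Set
NoLeadingBlock []          = ⊤
NoLeadingBlock (zero ∷ _)  = ⊥
NoLeadingBlock (suc _ ∷ _) = ⊤

multiplicity : List ℕ → List (List ℕ) → ℕ
multiplicity r qs = ∑ qs (λ q → ⟦ r == q ⟧)

block∷-idem : ∀ X → block∷ (block∷ X) ≡ block∷ X
block∷-idem []          = refl
block∷-idem (zero ∷ X)  = refl
block∷-idem (suc x ∷ X) = refl

block∷-≢-value : ∀ X rest → NoLeadingBlock rest → (block∷ X == rest) ≡ false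
block∷-≢-value []          []          _ = refl
block∷-≢-value (zero ∷ X)  []          _ = refl
block∷-≢-value (suc y ∷ X) []          _ = refl
block∷-≢-value []          (suc x ∷ R) _ = refl
block∷-≢-value (zero ∷ X)  (suc x ∷ R) _ = refl
block∷-≢-value (suc y ∷ X) (suc x ∷ R) _ = refl

block∷-==-block : ∀ r rest → NoLeadingBlock rest → ⟦ block∷ r == 0 ∷ rest ⟧ ≡ ⟦ r == rest ⟧ + ⟦ r == 0 ∷ rest ⟧
block∷-==-block []           []             _ = refl
block∷-==-block []           (suc x ∷ rest) _ = refl
block∷-==-block (zero ∷ r)   []             _ = refl
block∷-==-block (zero ∷ r)   (suc x ∷ rest) _ = refl
block∷-==-block (suc y ∷ r)  rest           _ = sym (+-identityʳ _)

separated-tail : ∀ rest → Separated (zero ∷ rest) → Separated rest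
separated-tail []          _   = tt
separated-tail (suc y ∷ r) sep = sep

separated-noLeadingBlock : ∀ rest → Separated (zero ∷ rest) → NoLeadingBlock rest
separated-noLeadingBlock []          _ = tt
separated-noLeadingBlock (suc _ ∷ _) _ = tt

separated-0∷ : ∀ q → NoLeadingBlock q → Separated q → Separated (0 ∷ q)
separated-0∷ []          _ _   = tt
separated-0∷ (suc x ∷ q) _ sep = sep

absorb-absent : ∀ u r → Separated r → count (suc u) r ≡ 0 → absorb (suc u) r ≡ r
absorb-absent u []                 _   _ = refl
absorb-absent u (zero ∷ [])        _   _ = refl
absorb-absent u (zero ∷ suc y ∷ r) sep c rewrite absorb-absent u (suc y ∷ r) sep c = refl
absorb-absent u (suc y ∷ r)        sep c with u ≡ᵇ y
... | false = cong (suc y ∷_) (absorb-absent u r sep c)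

multiplicity-expand : ∀ u pat r → Separated pat → count (suc u) pat ≡ 0 → Separated r → count (suc u) r ≡ 1 →
  multiplicity r (expand (suc u) pat) ≡ ⟦ absorb (suc u) r == pat ⟧

multiplicity-expand-value : ∀ u x rest r → Separated rest → count (suc u) rest ≡ 0 → (u ≡ᵇ x) ≡ false →
  Separated r → count (suc u) r ≡ 1 →
  ∑ (expand (suc u) rest) (λ q → ⟦ r == suc x ∷ q ⟧) ≡ ⟦ absorb (suc u) r == suc x ∷ rest ⟧
multiplicity-expand-value u x rest (zero ∷ r) _ _ _ _ _
  rewrite block∷-≢-value (absorb (suc u) r) (suc x ∷ rest) tt = ∑-zero (expand _ rest) (λ q → refl)
multiplicity-expand-value u x rest (suc y ∷ r) sep c u≢x sepᵣ cᵣ with u ≡ᵇ y in u≡ᵇy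
... | true rewrite block∷-≢-value (absorb (suc u) r) (suc x ∷ rest) tt | ≡ᵇ-true⇒≡ u y u≡ᵇy | u≢x =
  ∑-zero (expand _ rest) (λ q → refl)
... | false with y ≡ᵇ x
...   | false = ∑-zero (expand _ rest) (λ q → refl)
...   | true  = multiplicity-expand u rest r sep c sepᵣ cᵣ

multiplicity-expand-block-value : ∀ u rest y r → NoLeadingBlock rest → Separated r →
  count (suc u) (suc y ∷ r) ≡ 1 →
  multiplicity (suc y ∷ r) (expand (suc u) (zero ∷ rest)) ≡ ⟦ absorb (suc u) (suc y ∷ r) == zero ∷ rest ⟧
multiplicity-expand-block-value u rest y r noLead sepᵣ cᵣ with u ≡ᵇ y in u≡ᵇy
... | false rewrite trans (≡ᵇ-sym y u) u≡ᵇy =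
  trans (∑-map (0 ∷_) (expand (suc u) rest) _) (∑-zero (expand (suc u) rest) (λ q → refl))
... | true rewrite trans (≡ᵇ-sym y u) u≡ᵇy = begin
  ⟦ r == rest ⟧ + (⟦ r == 0 ∷ rest ⟧ + (0 + (0 + ∑ (map (0 ∷_) (expand (suc u) rest)) (λ q → ⟦ suc y ∷ r == q ⟧))))
    ≡⟨ cong (λ z → ⟦ r == rest ⟧ + (⟦ r == 0 ∷ rest ⟧ + z))
            (trans (∑-map (0 ∷_) (expand (suc u) rest) _) (∑-zero (expand (suc u) rest) (λ q → refl))) ⟩
  ⟦ r == rest ⟧ + (⟦ r == 0 ∷ rest ⟧ + 0)        ≡⟨ cong (⟦ r == rest ⟧ +_) (+-identityʳ _) ⟩
  ⟦ r == rest ⟧ + ⟦ r == 0 ∷ rest ⟧              ≡⟨ sym (block∷-==-block r rest noLead) ⟩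
  ⟦ block∷ r == 0 ∷ rest ⟧                       ≡⟨ cong (λ z → ⟦ block∷ z == 0 ∷ rest ⟧) (sym (absorb-absent u r sepᵣ (suc-injective cᵣ))) ⟩
  ⟦ block∷ (absorb (suc u) r) == 0 ∷ rest ⟧      ∎

multiplicity-expand-block-block : ∀ u rest y r → Separated (zero ∷ rest) → count (suc u) rest ≡ 0 →
  Separated (suc y ∷ r) → count (suc u) (zero ∷ suc y ∷ r) ≡ 1 →
  multiplicity (zero ∷ suc y ∷ r) (expand (suc u) (zero ∷ rest)) ≡ ⟦ absorb (suc u) (zero ∷ suc y ∷ r) == zero ∷ rest ⟧
multiplicity-expand-block-block u rest y r sep c sepᵣ cᵣ with u ≡ᵇ y in u≡ᵇy
... | false rewrite trans (≡ᵇ-sym y u) u≡ᵇy = trans (∑-map (0 ∷_) (expand v rest) _)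
  (trans (multiplicity-expand u rest (suc y ∷ r) (separated-tail rest sep) c sepᵣ (trans (cong (λ b → ⟦ b ⟧ + count v r) u≡ᵇy) cᵣ))
         (cong (λ b → ⟦ (if b then block∷ (absorb v r) else suc y ∷ absorb v r) == rest ⟧) u≡ᵇy))
  where
  v : ℕ
  v = suc u
... | true rewrite trans (≡ᵇ-sym y u) u≡ᵇy = begin
  ⟦ r == rest ⟧ + (⟦ r == 0 ∷ rest ⟧ + ∑ (map (0 ∷_) (expand v rest)) (λ q → ⟦ zero ∷ suc y ∷ r == q ⟧))
    ≡⟨ cong (λ z → ⟦ r == rest ⟧ + (⟦ r == 0 ∷ rest ⟧ + z))
            (trans (∑-map (0 ∷_) (expand v rest) _) (multiplicity-expand u rest (suc y ∷ r) (separated-tail rest sep) c sepᵣ cᵣ′)) ⟩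
  ⟦ r == rest ⟧ + (⟦ r == 0 ∷ rest ⟧ + ⟦ absorb v (suc y ∷ r) == rest ⟧)
    ≡⟨ cong (λ z → ⟦ r == rest ⟧ + (⟦ r == 0 ∷ rest ⟧ + ⟦ z ⟧)) absorbed ⟩
  ⟦ r == rest ⟧ + (⟦ r == 0 ∷ rest ⟧ + 0)        ≡⟨ cong (⟦ r == rest ⟧ +_) (+-identityʳ _) ⟩
  ⟦ r == rest ⟧ + ⟦ r == 0 ∷ rest ⟧              ≡⟨ sym (block∷-==-block r rest noLead) ⟩
  ⟦ block∷ r == 0 ∷ rest ⟧                       ≡⟨ cong (λ z → ⟦ z == 0 ∷ rest ⟧) (sym (trans (cong (block∷ ∘ block∷) r-fixed) (block∷-idem r))) ⟩
  ⟦ block∷ (block∷ (absorb v r)) == 0 ∷ rest ⟧   ∎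
  where
  v : ℕ
  noLead : NoLeadingBlock rest
  v = suc u
  noLead = separated-noLeadingBlock rest sep
  cᵣ′ : count v (suc y ∷ r) ≡ 1
  cᵣ′ = trans (cong (λ b → ⟦ b ⟧ + count v r) u≡ᵇy) cᵣ
  r-fixed : absorb v r ≡ r
  r-fixed = absorb-absent u r sepᵣ (suc-injective cᵣ)
  absorbed : (absorb v (suc y ∷ r) == rest) ≡ false
  absorbed rewrite u≡ᵇy | r-fixed = block∷-≢-value r rest noLead

multiplicity-expand u [] (zero ∷ r) _ _ _ _ rewrite block∷-≢-value (absorb (suc u) r) [] tt = refl
multiplicity-expand u [] (suc y ∷ r) _ _ _ _ with suc u ≡ᵇ suc y
... | true rewrite block∷-≢-value (absorb (suc u) r) [] tt = refl
... | false = refl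
multiplicity-expand u (suc x ∷ rest) r sep c sepᵣ cᵣ with u ≡ᵇ x in u≡ᵇx
multiplicity-expand u (suc x ∷ rest) r sep () sepᵣ cᵣ | true
... | false = trans (∑-map (suc x ∷_) (expand (suc u) rest) _) (multiplicity-expand-value u x rest r sep c u≡ᵇx sepᵣ cᵣ)
multiplicity-expand u (zero ∷ rest) (suc y ∷ r) sep c sepᵣ cᵣ =
  multiplicity-expand-block-value u rest y r (separated-noLeadingBlock rest sep) sepᵣ cᵣ
multiplicity-expand u (zero ∷ rest) (zero ∷ suc y ∷ r) sep c sepᵣ cᵣ =
  multiplicity-expand-block-block u rest y r sep c sepᵣ cᵣ

absorb-block∷ : ∀ v ys → absorb v (block∷ ys) ≡ block∷ (absorb v ys)
absorb-block∷ v []           = refl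
absorb-block∷ v (zero ∷ ys)  = sym (block∷-idem (absorb v ys))
absorb-block∷ v (suc y ∷ ys) = refl

compress-suc : ∀ u π → compress (suc (suc u)) π ≡ absorb (suc u) (compress (suc u) π)
compress-suc u [] = refl
compress-suc u (zero ∷ xs) =
  trans (cong block∷ (compress-suc u xs)) (sym (absorb-block∷ (suc u) (compress (suc u) xs)))
compress-suc u (suc x ∷ xs) with x <ᵇ u in x<u
... | true rewrite <ᵇ-weaken x u x<u =
  trans (cong block∷ (compress-suc u xs)) (sym (absorb-block∷ (suc u) (compress (suc u) xs)))
... | false with x <ᵇ suc u in x≤u
...   | true  rewrite <ᵇ-boundary x u x≤u x<u = cong block∷ (compress-suc u xs)
...   | false rewrite ≮ᵇ⇒≢ x u x≤u = cong (suc x ∷_) (compress-suc u xs)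

separated-block∷ : ∀ ys → Separated ys → Separated (block∷ ys)
separated-block∷ []           _   = tt
separated-block∷ (zero ∷ ys)  sep = sep
separated-block∷ (suc y ∷ ys) sep = sep

separated-compress : ∀ u π → Separated (compress (suc u) π)
separated-compress u []           = tt
separated-compress u (zero ∷ xs)  = separated-block∷ (compress (suc u) xs) (separated-compress u xs)
separated-compress u (suc x ∷ xs) with x <ᵇ u
... | true  = separated-block∷ (compress (suc u) xs) (separated-compress u xs)
... | false = separated-compress u xs

count-block∷ : ∀ y ys → count (suc y) (block∷ ys) ≡ count (suc y) ys
count-block∷ y []          = refl
count-block∷ y (zero ∷ ys) = refl
count-block∷ y (suc z ∷ ys) = refl

count-compress : ∀ v π → count (suc v) (compress (suc v) π) ≡ count (suc v) π
count-compress v [] = refl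
count-compress v (x ∷ xs) with x <ᵇ suc v in x≤v
... | true  = trans (count-block∷ v (compress (suc v) xs))
                    (trans (count-compress v xs) (cong (λ b → ⟦ b ⟧ + count (suc v) xs) (sym (<ᵇ⇒≢ x (suc v) x≤v))))
... | false = cong (⟦ suc v ≡ᵇ x ⟧ +_) (count-compress v xs)

compress-one : ∀ n π → InRange n π → compress 1 π ≡ π
compress-one n []          []       = refl
compress-one n (suc x ∷ π) (_ ∷ π∈) = cong (suc x ∷_) (compress-one n π π∈)

compress-all : ∀ n x π → InRange n (x ∷ π) → compress (suc n) (x ∷ π) ≡ 0 ∷ []
compress-all n (suc x) π (x<n ∷ π∈) rewrite x<n with π | π∈
... | []     | []  = refl
... | y ∷ π′ | π∈′ rewrite compress-all n y π′ π∈′ = refl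

∑-indicator : ∀ r qs (k : List ℕ → ℕ) → ∑ qs (λ q → ⟦ r == q ⟧ * k q) ≡ multiplicity r qs * k r
∑-indicator r []       k = refl
∑-indicator r (q ∷ qs) k with r == q in r≡q
... | true rewrite ==-true⇒≡ r q r≡q =
  trans (cong (k q + 0 +_) (∑-indicator q qs k)) (sym (*-distribʳ-+ (k q) 1 (multiplicity q qs)))
... | false = ∑-indicator r qs k

-- Pinnacles seen through block patterns

isolated : ℕ → List ℕ → Bool
isolated v (a ∷ b ∷ c ∷ r) = ((a ≡ᵇ 0) ∧ (b ≡ᵇ v) ∧ (c ≡ᵇ 0)) ∨ isolated v (b ∷ c ∷ r)
isolated v _               = false

startsWithBlock : List ℕ → Bool
startsWithBlock (zero ∷ _) = true
startsWithBlock _          = false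

isolated-value∷ : ∀ v a C → isolated v (suc a ∷ C) ≡ isolated v C
isolated-value∷ v a []          = refl
isolated-value∷ v a (x ∷ [])    = refl
isolated-value∷ v a (x ∷ y ∷ C) = refl

isolated-block∷ : ∀ v b d r → isolated v (0 ∷ b ∷ d ∷ r) ≡ ((b ≡ᵇ v) ∧ startsWithBlock (d ∷ r)) ∨ isolated v (b ∷ d ∷ r)
isolated-block∷ v b zero    r = refl
isolated-block∷ v b (suc d) r rewrite ∧-zeroʳ (b ≡ᵇ v) = refl

isolated-short : ∀ v L → length L ≤ 2 → isolated v L ≡ false
isolated-short v []          _ = refl
isolated-short v (x ∷ [])    _ = refl
isolated-short v (x ∷ y ∷ []) _ = refl
isolated-short v (x ∷ y ∷ z ∷ L) (s≤s (s≤s ()))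

length-block∷ : ∀ X → length (block∷ X) ≤ suc (length X)
length-block∷ []          = s≤s z≤n
length-block∷ (zero ∷ X)  = n≤1+n _
length-block∷ (suc x ∷ X) = ≤-refl

length-compress : ∀ v π → length (compress v π) ≤ length π
length-compress v []       = z≤n
length-compress v (x ∷ xs) with x <ᵇ v
... | true  = ≤-trans (length-block∷ (compress v xs)) (s≤s (length-compress v xs))
... | false = s≤s (length-compress v xs)

startsWithBlock-block∷ : ∀ X → startsWithBlock (block∷ X) ≡ true
startsWithBlock-block∷ []          = refl
startsWithBlock-block∷ (zero ∷ X)  = refl
startsWithBlock-block∷ (suc x ∷ X) = refl

isolated-block∷-block : ∀ v C → startsWithBlock C ≡ true → isolated v (block∷ C) ≡ isolated v C
isolated-block∷-block v (zero ∷ C) _ = refl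

startsWithBlock-compress : ∀ u c rest → startsWithBlock (compress (suc u) (c ∷ rest)) ≡ (c <ᵇ suc u)
startsWithBlock-compress u c rest with c <ᵇ suc u in c≤u
... | true = startsWithBlock-block∷ _
startsWithBlock-compress u (suc c) rest | false = refl

compress-∷ : ∀ v c rest → Σ ℕ (λ d → Σ (List ℕ) (λ r → compress v (c ∷ rest) ≡ d ∷ r))
compress-∷ v c rest with c <ᵇ v
... | false = c , compress v rest , refl
... | true with compress v rest
...   | []        = 0 , [] , refl
...   | zero ∷ X  = 0 , X , refl
...   | suc x ∷ X = 0 , suc x ∷ X , refl

elemᵇ-++ : ∀ v X Y → elemᵇ v (X ++ Y) ≡ elemᵇ v X ∨ elemᵇ v Y
elemᵇ-++ v []      Y = refl
elemᵇ-++ v (x ∷ X) Y rewrite elemᵇ-++ v X Y = sym (∨-assoc (v ≡ᵇ x) _ _)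

elemᵇ-singleton : ∀ v c b → elemᵇ v (if c then b ∷ [] else []) ≡ c ∧ (v ≡ᵇ b)
elemᵇ-singleton v true  b = ∨-identityʳ _
elemᵇ-singleton v false b = refl

isolated-block∷-compress : ∀ u a b c rest → (a <ᵇ suc u) ≡ true →
  isolated (suc u) (block∷ (compress (suc u) (b ∷ c ∷ rest)))
    ≡ (((a <ᵇ b) ∧ (c <ᵇ b)) ∧ (suc u ≡ᵇ b)) ∨ isolated (suc u) (compress (suc u) (b ∷ c ∷ rest))
isolated-block∷-compress u a zero c rest a≤u rewrite ∧-zeroʳ ((a <ᵇ 0) ∧ (c <ᵇ 0)) =
  isolated-block∷-block (suc u) (block∷ (compress (suc u) (c ∷ rest))) (startsWithBlock-block∷ _)
isolated-block∷-compress u a (suc b) c rest a≤u with b <ᵇ u in b<u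
... | true rewrite <ᵇ⇒≢ (suc b) (suc u) b<u | ∧-zeroʳ ((a <ᵇ suc b) ∧ (c <ᵇ suc b)) =
  isolated-block∷-block (suc u) (block∷ (compress (suc u) (c ∷ rest))) (startsWithBlock-block∷ _)
... | false with compress-∷ (suc u) c rest
...   | d , r , compressed = begin
  isolated v (block∷ (suc b ∷ compress v (c ∷ rest)))     ≡⟨ cong (λ X → isolated v (block∷ (suc b ∷ X))) compressed ⟩
  isolated v (0 ∷ suc b ∷ d ∷ r)                          ≡⟨ isolated-block∷ v (suc b) d r ⟩
  ((suc b ≡ᵇ v) ∧ startsWithBlock (d ∷ r)) ∨ isolated v (suc b ∷ d ∷ r)
    ≡⟨ cong (_∨ isolated v (suc b ∷ d ∷ r)) peak-here ⟩
  (peak ∧ (v ≡ᵇ suc b)) ∨ isolated v (suc b ∷ d ∷ r)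
    ≡⟨ cong (λ X → (peak ∧ (v ≡ᵇ suc b)) ∨ isolated v (suc b ∷ X)) (sym compressed) ⟩
  (peak ∧ (v ≡ᵇ suc b)) ∨ isolated v (suc b ∷ compress v (c ∷ rest)) ∎
  where
  v : ℕ
  peak : Bool
  v = suc u
  peak = (a <ᵇ suc b) ∧ (c <ᵇ suc b)
  c-block : startsWithBlock (d ∷ r) ≡ (c <ᵇ v)
  c-block = trans (cong startsWithBlock (sym compressed)) (startsWithBlock-compress u c rest)
  peak-here : (suc b ≡ᵇ v) ∧ startsWithBlock (d ∷ r) ≡ peak ∧ (v ≡ᵇ suc b)
  peak-here with v ≡ᵇ suc b in v≡ᵇb
  ... | false rewrite ≡ᵇ-sym (suc b) v | v≡ᵇb | ∧-zeroʳ peak = refl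
  ... | true rewrite ≡ᵇ-sym (suc b) v | v≡ᵇb | c-block | sym (≡ᵇ-true⇒≡ v (suc b) v≡ᵇb) | a≤u =
    sym (∧-identityʳ _)

isolated-compress-∷ : ∀ u a b c rest →
  isolated (suc u) (compress (suc u) (a ∷ b ∷ c ∷ rest))
    ≡ (((a <ᵇ b) ∧ (c <ᵇ b)) ∧ (suc u ≡ᵇ b)) ∨ isolated (suc u) (compress (suc u) (b ∷ c ∷ rest))
isolated-compress-∷ u zero b c rest = isolated-block∷-compress u zero b c rest refl
isolated-compress-∷ u (suc a) b c rest with a <ᵇ u in a<u
... | true  = isolated-block∷-compress u (suc a) b c rest a<u
... | false = trans (isolated-value∷ (suc u) a (compress (suc u) (b ∷ c ∷ rest)))
                    (sym (cong (_∨ isolated (suc u) (compress (suc u) (b ∷ c ∷ rest))) not-peak))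
  where
  not-peak : ((suc a <ᵇ b) ∧ (c <ᵇ b)) ∧ (suc u ≡ᵇ b) ≡ false
  not-peak with suc u ≡ᵇ b in u≡ᵇb
  ... | false = ∧-zeroʳ _
  ... | true rewrite sym (≡ᵇ-true⇒≡ (suc u) b u≡ᵇb) | a<u = refl

isolated-compress : ∀ u π → isolated (suc u) (compress (suc u) π) ≡ elemᵇ (suc u) (Pin π)
isolated-compress u []          = refl
isolated-compress u (a ∷ [])    =
  isolated-short (suc u) (compress (suc u) (a ∷ [])) (≤-trans (length-compress (suc u) (a ∷ [])) (s≤s z≤n))
isolated-compress u (a ∷ b ∷ []) =
  isolated-short (suc u) (compress (suc u) (a ∷ b ∷ [])) (length-compress (suc u) (a ∷ b ∷ []))
isolated-compress u (a ∷ b ∷ c ∷ rest) = begin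
  isolated (suc u) (compress (suc u) (a ∷ b ∷ c ∷ rest))
    ≡⟨ isolated-compress-∷ u a b c rest ⟩
  (peak ∧ (suc u ≡ᵇ b)) ∨ isolated (suc u) (compress (suc u) (b ∷ c ∷ rest))
    ≡⟨ cong₂ _∨_ (sym (elemᵇ-singleton (suc u) peak b)) (isolated-compress u (b ∷ c ∷ rest)) ⟩
  elemᵇ (suc u) (if peak then b ∷ [] else []) ∨ elemᵇ (suc u) (Pin (b ∷ c ∷ rest))
    ≡⟨ sym (elemᵇ-++ (suc u) (if peak then b ∷ [] else []) (Pin (b ∷ c ∷ rest))) ⟩
  elemᵇ (suc u) (Pin (a ∷ b ∷ c ∷ rest)) ∎
  where
  peak : Bool
  peak = (a <ᵇ b) ∧ (c <ᵇ b)

ExpandsTo : ℕ → List ℕ → List ℕ → Set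
ExpandsTo u pat q = Separated q × (∀ y → count (suc y) q ≡ ⟦ y ≡ᵇ u ⟧ + count (suc y) pat)

expand-expandsTo : ∀ u pat → Separated pat → count (suc u) pat ≡ 0 → All (ExpandsTo u pat) (expand (suc u) pat)
expand-expandsTo u [] _ _ = []
expand-expandsTo u (suc x ∷ rest) sep c =
  All.map⁺ (All.map (λ {q} → prepend {q}) (expand-expandsTo u rest sep (m+n≡0⇒n≡0 ⟦ u ≡ᵇ x ⟧ c)))
  where
  prepend : ∀ {q} → ExpandsTo u rest q → ExpandsTo u (suc x ∷ rest) (suc x ∷ q)
  prepend {q} (sep , counts) = sep , λ y → trans (cong (⟦ y ≡ᵇ x ⟧ +_) (counts y)) (m+[n+o]≡n+[m+o] ⟦ y ≡ᵇ x ⟧ ⟦ y ≡ᵇ u ⟧ (count (suc y) rest))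
expand-expandsTo u (zero ∷ rest) sep c =
  (separated-tail rest sep , λ y → refl) ∷ (sep , λ y → refl)
  ∷ (separated-0∷ (suc u ∷ rest) tt (separated-tail rest sep) , λ y → refl) ∷ (sep , λ y → refl)
  ∷ behind rest sep c
  where
  behind : ∀ rest → Separated (zero ∷ rest) → count (suc u) rest ≡ 0 →
    All (ExpandsTo u (zero ∷ rest)) (map (0 ∷_) (expand (suc u) rest))
  behind []             _   _ = []
  behind (suc x ∷ rest) sep c = All.map⁺ (All.map (λ {q} → prepend {q}) (All.zip (expand-expandsTo u (suc x ∷ rest) sep c , leading)))
    where
    leading : All NoLeadingBlock (expand (suc u) (suc x ∷ rest))
    leading = All.map⁺ (All.universal (λ _ → tt) (expand (suc u) rest))
    prepend : ∀ {q} → ExpandsTo u (suc x ∷ rest) q × NoLeadingBlock q → ExpandsTo u (zero ∷ suc x ∷ rest) (0 ∷ q)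
    prepend {q} ((sep , counts) , noLead) = separated-0∷ q noLead sep , counts

-- The shape of the pattern at threshold m + 1 of a permutation of [n].
Valid : ℕ → ℕ → List ℕ → Set
Valid n m q = Separated q × (∀ y → count (suc y) q ≡ ⟦ (m <ᵇ suc y) ∧ (y <ᵇ n) ⟧)

valid-absent : ∀ n u q → Valid n (suc u) q → count (suc u) q ≡ 0
valid-absent n u q (_ , counts) = trans (counts u) (cong (λ b → ⟦ b ∧ (u <ᵇ n) ⟧) (<ᵇ-irrefl u))

expand-valid : ∀ n u pat → (u <ᵇ n) ≡ true → Valid n (suc u) pat → All (Valid n u) (expand (suc u) pat)
expand-valid n u pat u<n valid@(sep , counts) =
  All.map (λ {q} → valid-expansion {q}) (expand-expandsTo u pat sep (valid-absent n u pat valid))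
  where
  one-more : ∀ y → ⟦ y ≡ᵇ u ⟧ + ⟦ (u <ᵇ y) ∧ (y <ᵇ n) ⟧ ≡ ⟦ (u <ᵇ suc y) ∧ (y <ᵇ n) ⟧
  one-more y with y ≡ᵇ u in y≡ᵇu
  ... | true rewrite ≡ᵇ-true⇒≡ y u y≡ᵇu | <ᵇ-irrefl u | <ᵇ-suc-refl u | u<n = refl
  ... | false rewrite <ᵇ-suc-≢ u y (trans (≡ᵇ-sym u y) y≡ᵇu) = refl
  valid-expansion : ∀ {q} → ExpandsTo u pat q → Valid n u q
  valid-expansion {q} (sepq , countsq) = sepq , λ y → trans (countsq y) (trans (cong (⟦ y ≡ᵇ u ⟧ +_) (counts y)) (one-more y))

valid-top : ∀ n → Valid n n (0 ∷ [])
valid-top n = tt , λ y → sym (cong ⟦_⟧ (outside n y))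
  where
  outside : ∀ n y → (n <ᵇ suc y) ∧ (y <ᵇ n) ≡ false
  outside zero    y       = refl
  outside (suc n) zero    = refl
  outside (suc n) (suc y) = outside n y

peakFactor : ℕ → ℕ → List ℕ → ℕ
peakFactor c v q = if isolated v q then c else 1

not-isolated : ∀ u q → count (suc u) q ≡ 0 → isolated (suc u) q ≡ false
not-isolated u []              _ = refl
not-isolated u (a ∷ [])        _ = refl
not-isolated u (a ∷ b ∷ [])    _ = refl
not-isolated u (a ∷ b ∷ c ∷ r) absent = cong₂ _∨_ middle (not-isolated u (b ∷ c ∷ r) absent′)
  where
  absent′ : count (suc u) (b ∷ c ∷ r) ≡ 0
  absent′ = m+n≡0⇒n≡0 ⟦ suc u ≡ᵇ a ⟧ absent
  middle : (a ≡ᵇ 0) ∧ (b ≡ᵇ suc u) ∧ (c ≡ᵇ 0) ≡ false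
  middle rewrite ≡ᵇ-sym b (suc u) | ⟦⟧≡0 (m+n≡0⇒m≡0 ⟦ suc u ≡ᵇ b ⟧ absent′) = ∧-zeroʳ (a ≡ᵇ 0)

isolated-0∷value : ∀ v x q → (suc x ≡ᵇ v) ≡ false → isolated v (0 ∷ suc x ∷ q) ≡ isolated v (suc x ∷ q)
isolated-0∷value v x []      _   = refl
isolated-0∷value v x (d ∷ r) x≢v rewrite isolated-block∷ v (suc x) d r | x≢v = refl

expand-sum-behind-block : ∀ u c x rest (φ : ℕ → ℕ) → (suc x ≡ᵇ suc u) ≡ false →
  ∑ (map (0 ∷_) (expand (suc u) (suc x ∷ rest))) (λ q → peakFactor c (suc u) q * φ (count 0 q))
    ≡ ∑ (expand (suc u) (suc x ∷ rest)) (λ q → peakFactor c (suc u) q * φ (suc (count 0 q)))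
expand-sum-behind-block u c x rest φ x≢v = begin
  ∑ (map (0 ∷_) (map (suc x ∷_) (expand v rest))) (λ q → peakFactor c v q * φ (count 0 q))
    ≡⟨ ∑-map (0 ∷_) (map (suc x ∷_) (expand v rest)) _ ⟩
  ∑ (map (suc x ∷_) (expand v rest)) (λ q → peakFactor c v (0 ∷ q) * φ (suc (count 0 q)))
    ≡⟨ ∑-map (suc x ∷_) (expand v rest) _ ⟩
  ∑ (expand v rest) (λ q → peakFactor c v (0 ∷ suc x ∷ q) * φ (suc (count 0 q)))
    ≡⟨ ∑-cong (expand v rest) (λ q → cong (λ b → (if b then c else 1) * φ (suc (count 0 q))) (isolated-0∷value v x q x≢v)) ⟩
  ∑ (expand v rest) (λ q → peakFactor c v (suc x ∷ q) * φ (suc (count 0 q)))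
    ≡⟨ sym (∑-map (suc x ∷_) (expand v rest) (λ q → peakFactor c v q * φ (suc (count 0 q)))) ⟩
  ∑ (map (suc x ∷_) (expand v rest)) (λ q → peakFactor c v q * φ (suc (count 0 q))) ∎
  where
  v : ℕ
  v = suc u

expand-sum-block : ∀ u c x rest (φ : ℕ → ℕ) → Separated (zero ∷ suc x ∷ rest) → count (suc u) (zero ∷ suc x ∷ rest) ≡ 0 →
  ∑ (expand (suc u) (suc x ∷ rest)) (λ q → peakFactor c (suc u) q * φ (suc (count 0 q)))
    ≡ count 0 rest * (φ (suc (count 0 rest ∸ 1)) + 2 * φ (suc (count 0 rest)) + c * φ (suc (suc (count 0 rest)))) →
  ∑ (expand (suc u) (zero ∷ suc x ∷ rest)) (λ q → peakFactor c (suc u) q * φ (count 0 q))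
    ≡ suc (count 0 rest) * (φ (count 0 rest) + 2 * φ (suc (count 0 rest)) + c * φ (suc (suc (count 0 rest))))
expand-sum-block u c x rest φ sep absent behind = begin
  peakFactor c v (v ∷ R) * φ h + (peakFactor c v (v ∷ 0 ∷ R) * φ (suc h) + (peakFactor c v (0 ∷ v ∷ R) * φ (suc h)
    + (peakFactor c v (0 ∷ v ∷ 0 ∷ R) * φ (suc (suc h)) + ∑ (map (0 ∷_) (expand v R)) (λ q → peakFactor c v q * φ (count 0 q)))))
    ≡⟨ cong₂ (λ a b → a * φ h + (b * φ (suc h) + (peakFactor c v (0 ∷ v ∷ R) * φ (suc h) + (peakFactor c v (0 ∷ v ∷ 0 ∷ R) * φ (suc (suc h)) + tail))))
             front front-0 ⟩
  1 * φ h + (1 * φ (suc h) + (peakFactor c v (0 ∷ v ∷ R) * φ (suc h) + (peakFactor c v (0 ∷ v ∷ 0 ∷ R) * φ (suc (suc h)) + tail)))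
    ≡⟨ cong₂ (λ a b → 1 * φ h + (1 * φ (suc h) + (a * φ (suc h) + (b * φ (suc (suc h)) + tail)))) behind-0 between ⟩
  1 * φ h + (1 * φ (suc h) + (1 * φ (suc h) + (c * φ (suc (suc h)) + tail)))
    ≡⟨ cong (λ z → 1 * φ h + (1 * φ (suc h) + (1 * φ (suc h) + (c * φ (suc (suc h)) + z)))) (trans later (pred-suc h)) ⟩
  1 * φ h + (1 * φ (suc h) + (1 * φ (suc h) + (c * φ (suc (suc h)) + h * (φ h + 2 * φ (suc h) + c * φ (suc (suc h))))))
    ≡⟨ collect h (φ h) (φ (suc h)) (φ (suc (suc h))) c ⟩
  suc h * (φ h + 2 * φ (suc h) + c * φ (suc (suc h))) ∎
  where
  v : ℕ
  R : List ℕ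
  h tail : ℕ
  v = suc u
  R = suc x ∷ rest
  h = count 0 rest
  tail = ∑ (map (0 ∷_) (expand v R)) (λ q → peakFactor c v q * φ (count 0 q))
  x≢v : (suc x ≡ᵇ v) ≡ false
  x≢v = trans (≡ᵇ-sym (suc x) v) (⟦⟧≡0 (m+n≡0⇒m≡0 ⟦ u ≡ᵇ x ⟧ absent))
  R-plain : isolated v R ≡ false
  R-plain = not-isolated u R absent
  front : peakFactor c v (v ∷ R) ≡ 1
  front rewrite isolated-value∷ v u R | R-plain = refl
  front-0 : peakFactor c v (v ∷ 0 ∷ R) ≡ 1
  front-0 rewrite isolated-value∷ v u (0 ∷ R) | not-isolated u (0 ∷ R) absent = refl
  behind-0 : peakFactor c v (0 ∷ v ∷ R) ≡ 1
  behind-0 rewrite isolated-block∷ v v (suc x) rest | isolated-value∷ v u R | R-plain | ∧-zeroʳ (v ≡ᵇ v) = refl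
  between : peakFactor c v (0 ∷ v ∷ 0 ∷ R) ≡ c
  between rewrite ≡ᵇ-refl u = refl
  later : tail ≡ h * (φ (suc (h ∸ 1)) + 2 * φ (suc h) + c * φ (suc (suc h)))
  later = trans (expand-sum-behind-block u c x rest φ x≢v) behind
  pred-suc : ∀ h → h * (φ (suc (h ∸ 1)) + 2 * φ (suc h) + c * φ (suc (suc h))) ≡ h * (φ h + 2 * φ (suc h) + c * φ (suc (suc h)))
  pred-suc zero    = refl
  pred-suc (suc k) = refl
  collect : ∀ h a b d c → 1 * a + (1 * b + (1 * b + (c * d + h * (a + 2 * b + c * d)))) ≡ suc h * (a + 2 * b + c * d)
  collect = solve-∀

expand-sum : ∀ u c pat (φ : ℕ → ℕ) → Separated pat → count (suc u) pat ≡ 0 →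
  ∑ (expand (suc u) pat) (λ q → peakFactor c (suc u) q * φ (count 0 q))
    ≡ count 0 pat * (φ (count 0 pat ∸ 1) + 2 * φ (count 0 pat) + c * φ (suc (count 0 pat)))
expand-sum u c [] φ _ _ = refl
expand-sum u c (suc x ∷ rest) φ sep absent =
  trans (∑-map (suc x ∷_) (expand (suc u) rest) _)
  (trans (∑-cong (expand (suc u) rest) (λ q → cong (λ b → (if b then c else 1) * φ (count 0 q)) (isolated-value∷ (suc u) x q)))
         (expand-sum u c rest φ sep (m+n≡0⇒n≡0 ⟦ u ≡ᵇ x ⟧ absent)))
expand-sum u c (zero ∷ []) φ _ _ rewrite ≡ᵇ-refl u = single (φ 0) (φ 1) (φ 2) c
  where
  single : ∀ a b d c → 1 * a + (1 * b + (1 * b + (c * d + 0))) ≡ 1 * (a + 2 * b + c * d)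
  single = solve-∀
expand-sum u c (zero ∷ suc x ∷ rest) φ sep absent =
  expand-sum-block u c x rest φ sep absent (expand-sum u c (suc x ∷ rest) (φ ∘ suc) sep absent)

-- Weighted permutation counts

markedWeight : (ℕ → Bool) → List ℕ → ℕ → ℕ
markedWeight a P v = if a v then peakWeight P v else 1

pinnacle : List ℕ → ℕ → Bool
pinnacle π v = elemᵇ v (Pin π)

weight : List ℕ → ℕ → List ℕ → ℕ
weight P zero    π = 1
weight P (suc m) π = markedWeight (pinnacle π) P (suc m) * weight P m π

patternWeight : List ℕ → ℕ → ℕ → List ℕ → ℕ
patternWeight P n m q = ∑ (Sn n) (λ π → ⟦ compress (suc m) π == q ⟧ * weight P m π)

patternWeight-zero : ∀ P n q → Valid n 0 q → patternWeight P n 0 q ≡ fill P 0 (count 0 q)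
patternWeight-zero P n q (_ , counts) with count 0 q in blocks
... | zero = begin
  ∑ (Sn n) (λ π → ⟦ compress 1 π == q ⟧ * 1)
    ≡⟨ ∑-congᴬ (Sn n) (Sn-permutation n) (λ π perm → trans (*-identityʳ _) (cong (λ z → ⟦ z == q ⟧) (compress-one n π (proj₁ perm)))) ⟩
  ∑ (Sn n) (λ π → ⟦ π == q ⟧)
    ≡⟨ matching-permutation n q (λ { zero → blocks ; (suc y) → counts y }) ⟩
  1 ∎
... | suc k = trans (∑-congᴬ (Sn n) (Sn-permutation n) unmatched) (∑-zero (Sn n) (λ _ → refl))
  where
  unmatched : ∀ π → Permutation n π → ⟦ compress 1 π == q ⟧ * 1 ≡ 0
  unmatched π (π∈ , _) rewrite compress-one n π π∈ with π == q in π≡q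
  ... | false = refl
  ... | true with () ← trans (sym (count-zero-permutation n π π∈)) (trans (cong (count 0) (==-true⇒≡ π q π≡q)) blocks)

patternWeight-suc-pointwise : ∀ P n m pat π → (m <ᵇ n) ≡ true → Separated pat → count (suc m) pat ≡ 0 → Permutation n π →
  ⟦ compress (suc (suc m)) π == pat ⟧ * weight P (suc m) π
    ≡ ∑ (expand (suc m) pat) (λ q → ⟦ compress (suc m) π == q ⟧ * (peakFactor (peakWeight P (suc m)) (suc m) q * weight P m π))
patternWeight-suc-pointwise P n m pat π m<n sep absent (_ , once , _) = sym (begin
  ∑ (expand v pat) (λ q → ⟦ r == q ⟧ * (peakFactor c v q * w))
    ≡⟨ ∑-indicator r (expand v pat) (λ q → peakFactor c v q * w) ⟩
  multiplicity r (expand v pat) * (peakFactor c v r * w)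
    ≡⟨ cong₂ (λ a b → a * (b * w)) (multiplicity-expand m pat r sep absent (separated-compress m π) r-once)
                                   (cong (λ b → if b then c else 1) (isolated-compress m π)) ⟩
  ⟦ absorb v r == pat ⟧ * (markedWeight (pinnacle π) P v * w)
    ≡⟨ cong (λ z → ⟦ z == pat ⟧ * (markedWeight (pinnacle π) P v * w)) (sym (compress-suc m π)) ⟩
  ⟦ compress (suc v) π == pat ⟧ * (markedWeight (pinnacle π) P v * w) ∎)
  where
  v c : ℕ
  r : List ℕ
  w : ℕ
  v = suc m
  c = peakWeight P v
  r = compress v π
  w = weight P m π
  r-once : count v r ≡ 1
  r-once = trans (count-compress m π) (once v m<n)

patternWeight≡fill : ∀ P n m → m ≤ n → ∀ q → Valid n m q → patternWeight P n m q ≡ fill P m (count 0 q)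
patternWeight≡fill P n zero _ q valid = patternWeight-zero P n q valid
patternWeight≡fill P n (suc m) m<n pat valid@(sep , _) = begin
  ∑ (Sn n) (λ π → ⟦ compress (suc v) π == pat ⟧ * weight P v π)
    ≡⟨ ∑-congᴬ (Sn n) (Sn-permutation n) (λ π → patternWeight-suc-pointwise P n m pat π m<ᵇn sep absent) ⟩
  ∑ (Sn n) (λ π → ∑ (expand v pat) (λ q → ⟦ compress v π == q ⟧ * (peakFactor c v q * weight P m π)))
    ≡⟨ ∑-swap (Sn n) (expand v pat) _ ⟩
  ∑ (expand v pat) (λ q → ∑ (Sn n) (λ π → ⟦ compress v π == q ⟧ * (peakFactor c v q * weight P m π)))
    ≡⟨ ∑-cong (expand v pat) (λ q → trans (∑-cong (Sn n) (λ π → m*[n*o]≡n*[m*o] ⟦ compress v π == q ⟧ (peakFactor c v q) (weight P m π)))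
                                           (∑-*ˡ (Sn n) (peakFactor c v q) _)) ⟩
  ∑ (expand v pat) (λ q → peakFactor c v q * patternWeight P n m q)
    ≡⟨ ∑-congᴬ (expand v pat) (expand-valid n m pat m<ᵇn valid)
               (λ q valid-q → cong (peakFactor c v q *_) (patternWeight≡fill P n m (<⇒≤ m<n) q valid-q)) ⟩
  ∑ (expand v pat) (λ q → peakFactor c v q * fill P m (count 0 q))
    ≡⟨ expand-sum m c pat (fill P m) sep absent ⟩
  fill P (suc m) (count 0 pat) ∎
  where
  v c : ℕ
  v = suc m
  c = peakWeight P v
  m<ᵇn : (m <ᵇ n) ≡ true
  m<ᵇn = Equivalence.to T-≡ (<⇒<ᵇ m<n)
  absent : count v pat ≡ 0
  absent = valid-absent n m pat valid

-- Sums over subsets of P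

infix 4 _⇔ᵇ_

_⇔ᵇ_ : Bool → Bool → Bool
true  ⇔ᵇ y = y
false ⇔ᵇ y = not y

⇔ᵇ-refl : ∀ b → (b ⇔ᵇ b) ≡ true
⇔ᵇ-refl true  = refl
⇔ᵇ-refl false = refl

⇔ᵇ-true⇒≡ : ∀ a b → (a ⇔ᵇ b) ≡ true → a ≡ b
⇔ᵇ-true⇒≡ true  true  _ = refl
⇔ᵇ-true⇒≡ false false _ = refl

all-true : ∀ {f : ℕ → Bool} {R} → all f R ≡ true → ∀ {v} → v ∈ R → f v ≡ true
all-true {f} {x ∷ R} holds (here refl) with f x
... | true = refl
all-true {f} {x ∷ R} holds (there v∈R) with f x
... | true = all-true holds v∈R

all-false : ∀ {f : ℕ → Bool} R → all f R ≡ false → Σ ℕ (λ v → v ∈ R × f v ≡ false)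
all-false {f} (x ∷ R) fails with f x in fx
... | false = x , here refl , fx
... | true with all-false R fails
...   | v , v∈R , fv = v , there v∈R , fv

all-intro : ∀ {f : ℕ → Bool} R → (∀ {v} → v ∈ R → f v ≡ true) → all f R ≡ true
all-intro []      holds = refl
all-intro (x ∷ R) holds rewrite holds (here refl) = all-intro R (λ v∈R → holds (there v∈R))

sameSetᵇ-true : ∀ n A B → sameSetᵇ n A B ≡ true → ∀ {v} → v ∈ range1 n → elemᵇ v A ≡ elemᵇ v B
sameSetᵇ-true n A B same {v} v∈ with elemᵇ v A | elemᵇ v B | all-true same v∈
... | true  | true  | _ = refl
... | false | false | _ = refl

sameSetᵇ-false : ∀ n A B → sameSetᵇ n A B ≡ false → Σ ℕ (λ v → v ∈ range1 n × elemᵇ v A ≢ elemᵇ v B)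
sameSetᵇ-false n A B differ with all-false (range1 n) differ
... | v , v∈ , bad with elemᵇ v A in inA | elemᵇ v B in inB | bad
...   | true  | true  | ()
...   | false | false | ()
...   | true  | false | _ = v , v∈ , λ same → contradiction (trans (sym inA) (trans same inB)) λ ()
...   | false | true  | _ = v , v∈ , λ same → contradiction (trans (sym inA) (trans same inB)) λ ()

sameSetᵇ-agree : ∀ n A B → sameSetᵇ n A B ≡ all (λ v → elemᵇ v A ⇔ᵇ elemᵇ v B) (range1 n)
sameSetᵇ-agree n A B with sameSetᵇ n A B in same
... | true  = sym (all-intro (range1 n) (λ {v} v∈ → subst (λ b → (elemᵇ v A ⇔ᵇ b) ≡ true)
                                                           (sameSetᵇ-true n A B same v∈) (⇔ᵇ-refl (elemᵇ v A))))
... | false with sameSetᵇ-false n A B same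
...   | v , v∈ , disagree with all (λ v → elemᵇ v A ⇔ᵇ elemᵇ v B) (range1 n) in agree
...     | false = refl
...     | true  = ⊥-elim (disagree (⇔ᵇ-true⇒≡ _ _ (all-true agree v∈)))

∏-agree-off : ∀ R x (f g : ℕ → ℕ) → count x R ≡ 0 → (∀ v → (v ≡ᵇ x) ≡ false → f v ≡ g v) → ∏ R f ≡ ∏ R g
∏-agree-off []      x f g _      _     = refl
∏-agree-off (y ∷ R) x f g absent agree with x ≡ᵇ y in x≡ᵇy
... | false = cong₂ _*_ (agree y (trans (≡ᵇ-sym y x) x≡ᵇy)) (∏-agree-off R x f g absent agree)

∏-split : ∀ R x (f g : ℕ → ℕ) → count x R ≡ 1 → (∀ v → (v ≡ᵇ x) ≡ false → f v ≡ g v) → g x ≡ 1 →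
  ∏ R f ≡ f x * ∏ R g
∏-split (y ∷ R) x f g once agree gx≡1 with x ≡ᵇ y in x≡ᵇy
... | true rewrite sym (≡ᵇ-true⇒≡ x y x≡ᵇy) | gx≡1 =
  cong (f x *_) (trans (∏-agree-off R x f g (suc-injective once) agree) (sym (+-identityʳ _)))
... | false rewrite agree y (trans (≡ᵇ-sym y x) x≡ᵇy) | ∏-split R x f g once agree gx≡1 = m*[n*o]≡n*[m*o] (g y) (f x) (∏ R g)

subsets-below : ∀ x xs → All (_< x) xs → All (All (_< x)) (subsets xs)
subsets-below x []       []            = [] ∷ []
subsets-below x (y ∷ ys) (y<x ∷ ys<x) =
  All.++⁺ (subsets-below x ys ys<x) (All.map⁺ (All.map (y<x ∷_) (subsets-below x ys ys<x)))

agreementWeight : ℕ → (ℕ → Bool) → List ℕ → ℕ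
agreementWeight n a Q = 2 ^ length Q * ∏ (range1 n) (λ v → ⟦ a v ⇔ᵇ elemᵇ v Q ⟧)

unmark : (ℕ → Bool) → ℕ → ℕ → Bool
unmark a x v = if v ≡ᵇ x then false else a v

unmark-off : ∀ a x v → (v ≡ᵇ x) ≡ false → unmark a x v ≡ a v
unmark-off a x v v≢x rewrite v≢x = refl

unmark-at : ∀ a x → unmark a x x ≡ false
unmark-at a x rewrite ≡ᵇ-refl x = refl

agreementWeight-∷ : ∀ n a x Q → count x (range1 n) ≡ 1 → elemᵇ x Q ≡ false →
  agreementWeight n a Q + agreementWeight n a (x ∷ Q) ≡ (if a x then 2 else 1) * agreementWeight n (unmark a x) Q
agreementWeight-∷ n a x Q once x∉Q = begin
  2 ^ length Q * ∏ R without + 2 ^ suc (length Q) * ∏ R with-x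
    ≡⟨ cong₂ (λ u w → 2 ^ length Q * u + 2 ^ suc (length Q) * w)
             (∏-split R x without rest once (λ v v≢x → cong (λ b → ⟦ b ⇔ᵇ elemᵇ v Q ⟧) (sym (unmark-off a x v v≢x))) rest-x)
             (∏-split R x with-x rest once off rest-x) ⟩
  2 ^ length Q * (⟦ a x ⇔ᵇ elemᵇ x Q ⟧ * G) + 2 ^ suc (length Q) * (⟦ a x ⇔ᵇ ((x ≡ᵇ x) ∨ elemᵇ x Q) ⟧ * G)
    ≡⟨ cong₂ (λ b c → 2 ^ length Q * (⟦ a x ⇔ᵇ b ⟧ * G) + 2 ^ suc (length Q) * (⟦ a x ⇔ᵇ (c ∨ b) ⟧ * G)) x∉Q (≡ᵇ-refl x) ⟩
  2 ^ length Q * (⟦ a x ⇔ᵇ false ⟧ * G) + 2 ^ suc (length Q) * (⟦ a x ⇔ᵇ true ⟧ * G)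
    ≡⟨ by-mark (a x) ⟩
  (if a x then 2 else 1) * (2 ^ length Q * G) ∎
  where
  R : List ℕ
  R = range1 n
  without with-x rest : ℕ → ℕ
  without v = ⟦ a v ⇔ᵇ elemᵇ v Q ⟧
  with-x v = ⟦ a v ⇔ᵇ elemᵇ v (x ∷ Q) ⟧
  rest v = ⟦ unmark a x v ⇔ᵇ elemᵇ v Q ⟧
  G : ℕ
  G = ∏ R rest
  rest-x : rest x ≡ 1
  rest-x rewrite unmark-at a x | x∉Q = refl
  off : ∀ v → (v ≡ᵇ x) ≡ false → with-x v ≡ rest v
  off v v≢x rewrite v≢x = refl
  by-mark : ∀ b → 2 ^ length Q * (⟦ b ⇔ᵇ false ⟧ * G) + 2 ^ suc (length Q) * (⟦ b ⇔ᵇ true ⟧ * G)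
                  ≡ (if b then 2 else 1) * (2 ^ length Q * G)
  by-mark true  = marked (2 ^ length Q) G
    where
    marked : ∀ p G → p * (0 * G) + 2 * p * (1 * G) ≡ 2 * (p * G)
    marked = solve-∀
  by-mark false = unmarked (2 ^ length Q) G
    where
    unmarked : ∀ p G → p * (1 * G) + 2 * p * (0 * G) ≡ 1 * (p * G)
    unmarked = solve-∀

∑-subsets : ∀ n (a : ℕ → Bool) P → StrictDec P → InRange n P →
  ∑ (subsets P) (agreementWeight n a) ≡ ∏ (range1 n) (markedWeight a P)
∑-subsets n a [] _ _ = trans (+-identityʳ _) (trans (*-identityˡ _) (∏-cong (range1 n) unmarked))
  where
  unmarked : ∀ v → ⟦ a v ⇔ᵇ false ⟧ ≡ markedWeight a [] v
  unmarked v with a v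
  ... | true  = refl
  ... | false = refl
∑-subsets n a (x ∷ xs) sd (x∈ ∷ xs∈) = begin
  ∑ (subsets xs ++ map (x ∷_) (subsets xs)) (agreementWeight n a)
    ≡⟨ ∑-++ (subsets xs) _ (agreementWeight n a) ⟩
  ∑ (subsets xs) (agreementWeight n a) + ∑ (map (x ∷_) (subsets xs)) (agreementWeight n a)
    ≡⟨ cong (∑ (subsets xs) (agreementWeight n a) +_) (∑-map (x ∷_) (subsets xs) (agreementWeight n a)) ⟩
  ∑ (subsets xs) (agreementWeight n a) + ∑ (subsets xs) (λ Q → agreementWeight n a (x ∷ Q))
    ≡⟨ sym (∑-+ (subsets xs) (agreementWeight n a) _) ⟩
  ∑ (subsets xs) (λ Q → agreementWeight n a Q + agreementWeight n a (x ∷ Q))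
    ≡⟨ ∑-congᴬ (subsets xs) (subsets-below x xs (strictDec-below sd))
               (λ Q Q<x → agreementWeight-∷ n a x Q once (elemᵇ-above Q Q<x x ≤-refl)) ⟩
  ∑ (subsets xs) (λ Q → c * agreementWeight n (unmark a x) Q)
    ≡⟨ ∑-*ˡ (subsets xs) c (agreementWeight n (unmark a x)) ⟩
  c * ∑ (subsets xs) (agreementWeight n (unmark a x))
    ≡⟨ cong (c *_) (∑-subsets n (unmark a x) xs (strictDec-tail sd) xs∈) ⟩
  c * ∏ (range1 n) (markedWeight (unmark a x) xs)
    ≡⟨ cong (_* ∏ (range1 n) (markedWeight (unmark a x) xs)) c-at-x ⟩
  markedWeight a (x ∷ xs) x * ∏ (range1 n) (markedWeight (unmark a x) xs)
    ≡⟨ sym (∏-split (range1 n) x (markedWeight a (x ∷ xs)) (markedWeight (unmark a x) xs) once off unmarked-x) ⟩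
  ∏ (range1 n) (markedWeight a (x ∷ xs)) ∎
  where
  c : ℕ
  c = if a x then 2 else 1
  once : count x (range1 n) ≡ 1
  once = trans (count-range1 n x) (cong ⟦_⟧ x∈)
  c-at-x : c ≡ markedWeight a (x ∷ xs) x
  c-at-x rewrite ≡ᵇ-refl x with a x
  ... | true  = refl
  ... | false = refl
  off : ∀ v → (v ≡ᵇ x) ≡ false → markedWeight a (x ∷ xs) v ≡ markedWeight (unmark a x) xs v
  off v v≢x rewrite unmark-off a x v v≢x | v≢x = refl
  unmarked-x : markedWeight (unmark a x) xs x ≡ 1
  unmarked-x rewrite unmark-at a x = refl

weight≡∏ : ∀ P m π → weight P m π ≡ ∏ (range1 m) (markedWeight (pinnacle π) P)
weight≡∏ P zero    π = refl
weight≡∏ P (suc m) π = begin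
  f (suc m) * weight P m π             ≡⟨ cong (f (suc m) *_) (weight≡∏ P m π) ⟩
  f (suc m) * ∏ (range1 m) f           ≡⟨ *-comm (f (suc m)) _ ⟩
  ∏ (range1 m) f * f (suc m)           ≡⟨ cong (∏ (range1 m) f *_) (sym (*-identityʳ _)) ⟩
  ∏ (range1 m) f * ∏ (suc m ∷ []) f    ≡⟨ sym (∏-++ (range1 m) (suc m ∷ []) f) ⟩
  ∏ (range1 m ++ suc m ∷ []) f         ≡⟨ cong (λ L → ∏ L f) (sym (range1-suc m)) ⟩
  ∏ (range1 (suc m)) f                 ∎
  where
  f : ℕ → ℕ
  f = markedWeight (pinnacle π) P

pinnacle-sum : ∀ n P π → StrictDec P → InRange n P →
  ∑ (subsets P) (λ Q → 2 ^ (length Q + 1) * ⟦ sameSetᵇ n (Pin π) Q ⟧) ≡ 2 * weight P n π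
pinnacle-sum n P π sd P∈ = begin
  ∑ (subsets P) (λ Q → 2 ^ (length Q + 1) * ⟦ sameSetᵇ n (Pin π) Q ⟧)
    ≡⟨ ∑-cong (subsets P) double ⟩
  ∑ (subsets P) (λ Q → 2 * agreementWeight n (pinnacle π) Q)
    ≡⟨ ∑-*ˡ (subsets P) 2 _ ⟩
  2 * ∑ (subsets P) (agreementWeight n (pinnacle π))
    ≡⟨ cong (2 *_) (trans (∑-subsets n (pinnacle π) P sd P∈) (sym (weight≡∏ P n π))) ⟩
  2 * weight P n π ∎
  where
  double : ∀ Q → 2 ^ (length Q + 1) * ⟦ sameSetᵇ n (Pin π) Q ⟧ ≡ 2 * agreementWeight n (pinnacle π) Q
  double Q = begin
    2 ^ (length Q + 1) * ⟦ sameSetᵇ n (Pin π) Q ⟧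
      ≡⟨ cong₂ _*_ (cong (2 ^_) (+-comm (length Q) 1)) (trans (cong ⟦_⟧ (sameSetᵇ-agree n (Pin π) Q)) (⟦all⟧ _ (range1 n))) ⟩
    2 * 2 ^ length Q * ∏ (range1 n) (λ v → ⟦ pinnacle π v ⇔ᵇ elemᵇ v Q ⟧)
      ≡⟨ *-assoc 2 (2 ^ length Q) _ ⟩
    2 * agreementWeight n (pinnacle π) Q ∎

∑-weight : ∀ n → 1 ≤ n → ∀ P → ∑ (Sn n) (weight P n) ≡ fill P n 1
∑-weight n 1≤n P = begin
  ∑ (Sn n) (weight P n)            ≡⟨ ∑-congᴬ (Sn n) (Sn-permutation n) fully-compressed ⟩
  patternWeight P n n (0 ∷ [])     ≡⟨ patternWeight≡fill P n n ≤-refl (0 ∷ []) (valid-top n) ⟩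
  fill P n 1                       ∎
  where
  fully-compressed : ∀ π → Permutation n π → weight P n π ≡ ⟦ compress (suc n) π == 0 ∷ [] ⟧ * weight P n π
  fully-compressed []      (_ , _ , len) = ⊥-elim (<-irrefl len 1≤n)
  fully-compressed (x ∷ π) (π∈ , _ , _) rewrite compress-all n x π π∈ = sym (+-identityʳ _)

lhs≡2*fill : ∀ n → 1 ≤ n → ∀ P → StrictDec P → InRange n P → lhs n P ≡ 2 * fill P n 1
lhs≡2*fill n 1≤n P sd P∈ = begin
  ∑ (subsets P) (λ Q → 2 ^ (length Q + 1) * pnCard n Q)
    ≡⟨ ∑-cong (subsets P) (λ Q → trans (cong (2 ^ (length Q + 1) *_) (length-filter _ (Sn n))) (sym (∑-*ˡ (Sn n) (2 ^ (length Q + 1)) _))) ⟩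
  ∑ (subsets P) (λ Q → ∑ (Sn n) (λ π → 2 ^ (length Q + 1) * ⟦ sameSetᵇ n (Pin π) Q ⟧))
    ≡⟨ ∑-swap (subsets P) (Sn n) _ ⟩
  ∑ (Sn n) (λ π → ∑ (subsets P) (λ Q → 2 ^ (length Q + 1) * ⟦ sameSetᵇ n (Pin π) Q ⟧))
    ≡⟨ ∑-cong (Sn n) (λ π → pinnacle-sum n P π sd P∈) ⟩
  ∑ (Sn n) (λ π → 2 * weight P n π)
    ≡⟨ ∑-*ˡ (Sn n) 2 _ ⟩
  2 * ∑ (Sn n) (weight P n)
    ≡⟨ cong (2 *_) (∑-weight n 1≤n P) ⟩
  2 * fill P n 1 ∎

-- Opened only here: an unqualified +_ would make every section (n +_) above ambiguous.
open import Data.Integer using (+_)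

mainTheorem3 : (n : ℕ) → 1 ≤ n → (P : List ℕ) → StrictDec P →
    All (λ p → 1 ≤ p) P → All (λ p → p ≤ n) P →
    + (lhs n P) ≡ rhs n P
mainTheorem3 (suc m) 1≤n P sd P≥1 P≤n = begin
  + lhs (suc m) P            ≡⟨ cong +_ (trans (lhs≡2*fill (suc m) 1≤n P sd P∈) (sym (fill⋆-one P m))) ⟩
  + fill⋆ P (suc m) 1        ≡⟨ fill⋆≡H P (suc m) 1 ⟩
  H P (suc m) (+ 1)          ≡⟨ H≡walkSum P (suc m) (+ 0) sd P≥1 P≤n ⟩
  rhs (suc m) P              ∎
  where
  P∈ : InRange (suc m) P
  P∈ = All.zipWith (λ (p≥1 , p≤n) → inRange-intro p≥1 p≤n) (P≥1 , P≤n)
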